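{- Fix integers $r,s\ge 1$ and $u_1,\dots,u_{r+s},t_1,\dots,t_{r+s}\ge 0$. Then the formal power series $$\sum_{\substack{n_1,\dots,n_r\ge 0,\ d_1,\dots,d_r\ge 1\\ n_{r+1},\dots,n_{r+s}\ge 1,\ d_{r+1},\dots,d_{r+s}\ge1\\ d_1+\cdots+d_r=d_{r+1}+\cdots+d_{r+s}}}\ \prod_{i=1}^{r+s}n_i^{u_i}d_i^{t_i}\cdot q^{\sum_{i=1}^{r+s}n_id_i}$$ is a finite $\mathbb{Q}$-linear combination of series of the form $$\sum_{\substack{\tilde n_1>\cdots>\tilde n_f\ge 0,\ \tilde d_1,\dots,\tilde d_f\ge 1\\ \tilde n_{f+1}>\cdots>\tilde n_{f+g}\ge 1,\ \tilde d_{f+1},\dots,\tilde d_{f+g}\ge1\\ \tilde d_1+\cdots+\tilde d_f=\tilde d_{f+1}+\cdots+\tilde d_{f+g}}}\ \prod_{i=1}^{f+g}\tilde n_i^{\tilde u_i}\tilde d_i^{\tilde t_i}\cdot q^{\sum_{i=1}^{f+g}\tilde n_i\tilde d_i}$$ with $f,g\ge 1$, $\tilde u_i,\tilde t_i\ge 0$ and $\sum_{i=1}^{f+g}(\tilde u_i+\tilde t_i+1)\le\sum_{i=1}^{r+s}(u_i+t_i+1)$. Moreover, if $t_1,\dots,t_{r+s}\ge 1$, then (in this combination) all $\tilde t_i\ge 1$; and if $u_1,\dots,u_{r+s}\ge1$, then all $\tilde u_i\ge 1$.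
   Context: $q$ is a formal variable; the sums are formal power series in $q$, and the convention $0^0=1$ is used for the factors $n_i^{u_i}$ with $n_i=0$. -}

module Defs where

open import Data.Nat using (ℕ; zero; suc; _+_; _*_; _^_; _≤_; _<ᵇ_; _≡ᵇ_)
open import Data.Bool using (Bool; true; false; _∧_; if_then_else_)
open import Data.List using (List; []; _∷_; [_]; concatMap; map; upTo)
import Data.List as L
open import Data.Nat.ListAction using () renaming (sum to sumL)
open import Data.Vec using (Vec; []; _∷_; zipWith; take; drop; toList)
import Data.Vec as V
open import Data.Vec.Relation.Unary.All using (All)
open import Data.Rational using (ℚ; 0ℚ; _/_)
import Data.Rational as Q
open import Data.Integer using (+_)
open import Data.Product using (_×_)

tuples : (k N : ℕ) → List (Vec ℕ k)
tuples zero    N = [ [] ]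
tuples (suc k) N = concatMap (λ x → map (x ∷_) (tuples k N)) (upTo (suc N))

allPos : ∀ {k} → Vec ℕ k → Bool
allPos []       = true
allPos (x ∷ xs) = (0 <ᵇ x) ∧ allPos xs

strictDec : ∀ {k} → Vec ℕ k → Bool
strictDec []             = true
strictDec (x ∷ [])       = true
strictDec (x ∷ y ∷ rest) = (y <ᵇ x) ∧ strictDec (y ∷ rest)

prodV : ∀ {k} → Vec ℕ k → ℕ
prodV = V.foldr _ _*_ 1

-- ∏ nᵢ^{uᵢ} dᵢ^{tᵢ}   (with 0^0 = 1, as for ℕ's _^_)
monomial : ∀ {k} → (ns ds u t : Vec ℕ k) → ℕ
monomial ns ds u t = prodV (zipWith _*_ (zipWith _^_ ns u) (zipWith _^_ ds t))

condS : (r s N : ℕ) → (ns ds : Vec ℕ (r + s)) → Bool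
condS r s N ns ds =
  allPos ds ∧ allPos (drop r ns) ∧ (V.sum (take r ds) ≡ᵇ V.sum (drop r ds))
    ∧ (V.sum (zipWith _*_ ns ds) ≡ᵇ N)

condT : (f g N : ℕ) → (ns ds : Vec ℕ (f + g)) → Bool
condT f g N ns ds = condS f g N ns ds ∧ strictDec (take f ns) ∧ strictDec (drop f ns)

-- sum over all (ns, ds) ∈ {0..N}^k × {0..N}^k satisfying a condition.
-- Every term of the series contributing to q^N has all nᵢ, dᵢ ≤ N
--, so this is the exact coefficient of q^N.
boxSum : (k N : ℕ) → (Vec ℕ k → Vec ℕ k → Bool) → (Vec ℕ k → Vec ℕ k → ℕ) → ℕ
boxSum k N c w =
  sumL (concatMap (λ ns → map (λ ds → if c ns ds then w ns ds else 0) (tuples k N))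
                   (tuples k N))

coeffS : (r s : ℕ) → (u t : Vec ℕ (r + s)) → ℕ → ℕ
coeffS r s u t N = boxSum (r + s) N (condS r s N) (λ ns ds → monomial ns ds u t)

coeffT : (f g : ℕ) → (u t : Vec ℕ (f + g)) → ℕ → ℕ
coeffT f g u t N = boxSum (f + g) N (condT f g N) (λ ns ds → monomial ns ds u t)

weight : ∀ {k} → Vec ℕ k → Vec ℕ k → ℕ
weight u t = V.sum (zipWith (λ a b → a + b + 1) u t)

-- one term c · T_{f,g}(ũ, t̃) of a ℚ-linear combination
record Term : Set where
  constructor term
  field
    coeff : ℚ
    f g   : ℕ
    ũ t̃   : Vec ℕ (f + g)

fromℕℚ : ℕ → ℚ
fromℕℚ n = + n / 1

combCoeff : List Term → ℕ → ℚ
combCoeff []                       N = 0ℚ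
combCoeff (term c f g ũ t̃ ∷ rest) N =
  c Q.* fromℕℚ (coeffT f g ũ t̃ N) Q.+ combCoeff rest N

Admissible : ∀ {k} → (u t : Vec ℕ k) → Term → Set
Admissible u t (term c f g ũ t̃) =
  1 ≤ f × 1 ≤ g × weight ũ t̃ ≤ weight u t
  × (All (1 ≤_) t → All (1 ≤_) t̃)
  × (All (1 ≤_) u → All (1 ≤_) ũ)

module Submission where

-- The coefficient of q^N is a sum over two blocks of links (nᵢ, dᵢ) ∈ [0, N]², with nᵢ ≥ 0 on the left,
-- nᵢ ≥ 1 on the right and equal d-sums. Each block is made strictly decreasing in n by inserting its links
-- one at a time into an already decreasing chain: a new link (n, d) goes before or after a link (n', d'),
-- or n = n' and the two merge into one link (n, e), e = d + d', with u-exponent u + u' and weight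
-- Σ_{d+d'=e, d,d'≥1} d^t d'^t'. That weight is a polynomial in e of degree ≤ t + t' + 1 (binomial basis,
-- induction on t'), and apart from the term −0^t e^t' it has no constant term, so it re-expands into links
-- with t-exponents j ≤ t + t' + 1, where j ≥ 1 unless j = t'. Hence no step increases Σ (uᵢ + tᵢ + 1) or
-- destroys uᵢ ≥ 1 or tᵢ ≥ 1.

open import Data.Bool using (Bool; true; false; _∧_; T; if_then_else_)
open import Data.Bool.Properties using (∧-assoc; ∧-comm; ∧-zeroʳ; ∧-identityʳ)
open import Data.Empty using (⊥-elim)
import Data.Integer as ℤ
import Data.Integer.Properties as ℤ
import Data.Integer.Tactic.RingSolver as ℤ-Solver
open import Data.List using (List; []; _∷_; map; concatMap; upTo; _++_; length)
import Data.List.Properties as List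
open import Data.List.Membership.Propositional using (_∈_)
open import Data.List.Membership.Propositional.Properties using (∈-upTo⁻)
open import Data.List.Relation.Unary.All using (All; []; _∷_)
import Data.List.Relation.Unary.All as All
open import Data.List.Relation.Unary.All.Properties using (++⁺; concat⁺; map⁺)
open import Data.List.Relation.Unary.Any using (here; there)
open import Data.Maybe using (Maybe; just; nothing)
open import Data.Nat as ℕ using (ℕ; zero; suc; _<_; _≤_; _<ᵇ_; _≡ᵇ_; _≤ᵇ_; _∸_; _^_; z≤n; s≤s)
open import Data.Nat.Combinatorics using (_C_; nCk+nC[k+1]≡[n+1]C[k+1]; nC1≡n)
open import Data.Nat.ListAction using () renaming (sum to sumL)
import Data.Nat.Properties as ℕ
import Data.Nat.Tactic.RingSolver as ℕ-Solver
open import Data.Product using (Σ; _×_; _,_; proj₁; proj₂; map₂)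
open import Data.Rational as ℚ using (ℚ; _+_; _*_; -_; 0ℚ; 1ℚ; toℚᵘ)
open import Data.Rational.Properties
  using (+-*-commutativeRing; _≟_; +-identityˡ; +-identityʳ; +-assoc; +-comm; *-zeroˡ; *-zeroʳ; *-identityˡ; *-identityʳ; *-assoc;
         *-distribˡ-+; *-distribʳ-+; toℚᵘ-injective; toℚᵘ-fromℚᵘ; toℚᵘ-homo-+; toℚᵘ-homo-*)
import Data.Rational.Unnormalised as ℚᵘ
import Data.Rational.Unnormalised.Properties as ℚᵘ
open import Data.Sum using (inj₁; inj₂)
open import Data.Unit using (tt)
open import Data.Vec as V using (Vec; []; _∷_; take; drop; zipWith) renaming (_++_ to _++ᵥ_)
open import Data.Vec.Properties using (++-injective; take++drop≡id; length-toList)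
open import Data.Vec.Relation.Unary.All as VecAll using ([]; _∷_)
import Data.Vec.Relation.Unary.All.Properties as VecAllₚ
open import Function using (_∘_)
open import Relation.Binary using (tri<; tri≈; tri>)
open import Relation.Binary.PropositionalEquality
open import Relation.Nullary using (¬_)
open import Relation.Nullary.Decidable using (dec⇒maybe)
import Tactic.RingSolver.Core.AlmostCommutativeRing as ACR
open import Tactic.RingSolver using (solve-∀)

open import Defs

ℚ-ring : ACR.AlmostCommutativeRing _ _
ℚ-ring = ACR.fromCommutativeRing +-*-commutativeRing (λ x → dec⇒maybe (0ℚ ≟ x))

ℕ→ℚᵘ : ℕ → ℚᵘ.ℚᵘ
ℕ→ℚᵘ n = ℚᵘ.mkℚᵘ (ℤ.+ n) 0

fromℕℚ-+ : ∀ m n → fromℕℚ (m ℕ.+ n) ≡ fromℕℚ m + fromℕℚ n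
fromℕℚ-+ m n = toℚᵘ-injective (begin
  toℚᵘ (fromℕℚ (m ℕ.+ n))               ≈⟨ toℚᵘ-fromℚᵘ (ℕ→ℚᵘ (m ℕ.+ n)) ⟩
  ℕ→ℚᵘ (m ℕ.+ n)                        ≈⟨ ℚᵘ.*≡* (trans (cong (ℤ._* ℤ.1ℤ) (ℤ.pos-+ m n)) (lemma (ℤ.+ m) (ℤ.+ n))) ⟩
  ℕ→ℚᵘ m ℚᵘ.+ ℕ→ℚᵘ n                    ≈⟨ ℚᵘ.+-cong (toℚᵘ-fromℚᵘ (ℕ→ℚᵘ m)) (toℚᵘ-fromℚᵘ (ℕ→ℚᵘ n)) ⟨
  toℚᵘ (fromℕℚ m) ℚᵘ.+ toℚᵘ (fromℕℚ n)   ≈⟨ toℚᵘ-homo-+ (fromℕℚ m) (fromℕℚ n) ⟨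
  toℚᵘ (fromℕℚ m + fromℕℚ n)             ∎)
  where
  open ℚᵘ.≃-Reasoning
  lemma : ∀ x y → (x ℤ.+ y) ℤ.* ℤ.1ℤ ≡ (x ℤ.* ℤ.1ℤ ℤ.+ y ℤ.* ℤ.1ℤ) ℤ.* (ℤ.1ℤ ℤ.* ℤ.1ℤ)
  lemma = ℤ-Solver.solve-∀

fromℕℚ-* : ∀ m n → fromℕℚ (m ℕ.* n) ≡ fromℕℚ m * fromℕℚ n
fromℕℚ-* m n = toℚᵘ-injective (begin
  toℚᵘ (fromℕℚ (m ℕ.* n))               ≈⟨ toℚᵘ-fromℚᵘ (ℕ→ℚᵘ (m ℕ.* n)) ⟩
  ℕ→ℚᵘ (m ℕ.* n)                        ≈⟨ ℚᵘ.*≡* (trans (cong (ℤ._* ℤ.1ℤ) (ℤ.pos-* m n)) (lemma (ℤ.+ m) (ℤ.+ n))) ⟩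
  ℕ→ℚᵘ m ℚᵘ.* ℕ→ℚᵘ n                    ≈⟨ ℚᵘ.*-cong (toℚᵘ-fromℚᵘ (ℕ→ℚᵘ m)) (toℚᵘ-fromℚᵘ (ℕ→ℚᵘ n)) ⟨
  toℚᵘ (fromℕℚ m) ℚᵘ.* toℚᵘ (fromℕℚ n)   ≈⟨ toℚᵘ-homo-* (fromℕℚ m) (fromℕℚ n) ⟨
  toℚᵘ (fromℕℚ m * fromℕℚ n)             ∎)
  where
  open ℚᵘ.≃-Reasoning
  lemma : ∀ x y → (x ℤ.* y) ℤ.* ℤ.1ℤ ≡ (x ℤ.* y) ℤ.* (ℤ.1ℤ ℤ.* ℤ.1ℤ)
  lemma = ℤ-Solver.solve-∀

T-∧⁻ : ∀ a {b} → T (a ∧ b) → T a × T b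
T-∧⁻ true t = tt , t

T-∧⁺ : ∀ {a b} → T a → T b → T (a ∧ b)
T-∧⁺ {true} _ t = t

T-ext : ∀ {a b} → (T a → T b) → (T b → T a) → a ≡ b
T-ext {true}  {true}  _ _ = refl
T-ext {true}  {false} f _ = ⊥-elim (f tt)
T-ext {false} {true}  _ g = ⊥-elim (g tt)
T-ext {false} {false} _ _ = refl

∑ : {A : Set} → List A → (A → ℚ) → ℚ
∑ []       f = 0ℚ
∑ (x ∷ xs) f = f x + ∑ xs f

module _ {A : Set} where

  ∑-cong-∈ : ∀ xs {f g : A → ℚ} → (∀ x → x ∈ xs → f x ≡ g x) → ∑ xs f ≡ ∑ xs g
  ∑-cong-∈ []       eq = refl
  ∑-cong-∈ (x ∷ xs) eq = cong₂ _+_ (eq x (here refl)) (∑-cong-∈ xs (λ y y∈xs → eq y (there y∈xs)))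

  ∑-cong : ∀ xs {f g : A → ℚ} → (∀ x → f x ≡ g x) → ∑ xs f ≡ ∑ xs g
  ∑-cong xs eq = ∑-cong-∈ xs (λ x _ → eq x)

  ∑-zero : ∀ xs {f : A → ℚ} → (∀ x → f x ≡ 0ℚ) → ∑ xs f ≡ 0ℚ
  ∑-zero []       eq = refl
  ∑-zero (x ∷ xs) eq = trans (cong₂ _+_ (eq x) (∑-zero xs eq)) (+-identityˡ 0ℚ)

  ∑-+ : ∀ xs (f g : A → ℚ) → ∑ xs (λ x → f x + g x) ≡ ∑ xs f + ∑ xs g
  ∑-+ []       f g = refl
  ∑-+ (x ∷ xs) f g = trans (cong ((f x + g x) +_) (∑-+ xs f g)) (interchange (f x) (g x) (∑ xs f) (∑ xs g))
    where
    interchange : ∀ a b c d → a + b + (c + d) ≡ a + c + (b + d)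
    interchange = solve-∀ ℚ-ring

  *-distribˡ-∑ : ∀ c xs (f : A → ℚ) → c * ∑ xs f ≡ ∑ xs (λ x → c * f x)
  *-distribˡ-∑ c []       f = *-zeroʳ c
  *-distribˡ-∑ c (x ∷ xs) f = trans (*-distribˡ-+ c (f x) (∑ xs f)) (cong (c * f x +_) (*-distribˡ-∑ c xs f))

  *-distribʳ-∑ : ∀ c xs (f : A → ℚ) → ∑ xs f * c ≡ ∑ xs (λ x → f x * c)
  *-distribʳ-∑ c []       f = *-zeroˡ c
  *-distribʳ-∑ c (x ∷ xs) f = trans (*-distribʳ-+ c (f x) (∑ xs f)) (cong (f x * c +_) (*-distribʳ-∑ c xs f))

  ∑-++ : ∀ xs ys (f : A → ℚ) → ∑ (xs ++ ys) f ≡ ∑ xs f + ∑ ys f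
  ∑-++ []       ys f = sym (+-identityˡ (∑ ys f))
  ∑-++ (x ∷ xs) ys f = trans (cong (f x +_) (∑-++ xs ys f)) (sym (+-assoc (f x) (∑ xs f) (∑ ys f)))

  ∑-map : ∀ {B : Set} (g : B → A) xs (f : A → ℚ) → ∑ (map g xs) f ≡ ∑ xs (f ∘ g)
  ∑-map g []       f = refl
  ∑-map g (x ∷ xs) f = cong (f (g x) +_) (∑-map g xs f)

  ∑-concatMap : ∀ {B : Set} (g : B → List A) xs (f : A → ℚ) → ∑ (concatMap g xs) f ≡ ∑ xs (λ y → ∑ (g y) f)
  ∑-concatMap g []       f = refl
  ∑-concatMap g (x ∷ xs) f = trans (∑-++ (g x) (concatMap g xs) f) (cong (∑ (g x) f +_) (∑-concatMap g xs f))

∑-comm : ∀ {A B : Set} (xs : List A) (ys : List B) (f : A → B → ℚ) →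
  ∑ xs (λ x → ∑ ys (f x)) ≡ ∑ ys (λ y → ∑ xs (λ x → f x y))
∑-comm []       ys f = sym (∑-zero ys (λ _ → refl))
∑-comm (x ∷ xs) ys f = trans (cong (∑ ys (f x) +_) (∑-comm xs ys f)) (sym (∑-+ ys (f x) (λ y → ∑ xs (λ x' → f x' y))))

∑< : ℕ → (ℕ → ℚ) → ℚ
∑< n = ∑ (upTo n)

∑<-cong : ∀ n {f g : ℕ → ℚ} → (∀ x → x < n → f x ≡ g x) → ∑< n f ≡ ∑< n g
∑<-cong n eq = ∑-cong-∈ (upTo n) (λ x x∈ → eq x (∈-upTo⁻ x∈))

∑<-suc : ∀ n f → ∑< (suc n) f ≡ ∑< n f + f n
∑<-suc n f = begin
  ∑ (upTo (suc n)) f        ≡⟨ cong (λ xs → ∑ xs f) (List.upTo-∷ʳ n) ⟨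
  ∑ (upTo n ++ n ∷ []) f    ≡⟨ ∑-++ (upTo n) (n ∷ []) f ⟩
  ∑< n f + (f n + 0ℚ)       ≡⟨ cong (∑< n f +_) (+-identityʳ (f n)) ⟩
  ∑< n f + f n              ∎
  where open ≡-Reasoning

∑<-suc-shift : ∀ n f → ∑< (suc n) f ≡ f 0 + ∑< n (f ∘ suc)
∑<-suc-shift n f = cong (f 0 +_) (trans (cong (λ xs → ∑ xs f) (sym (List.map-upTo suc n))) (∑-map suc (upTo n) f))

-- Iverson brackets

[_]·_ : Bool → ℚ → ℚ
[ true  ]· x = x
[ false ]· x = 0ℚ

[]·-true : ∀ {b} x → T b → [ b ]· x ≡ x
[]·-true {true} x _ = refl

[]·-false : ∀ {b} x → ¬ T b → [ b ]· x ≡ 0ℚ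
[]·-false {true}  x ¬t = ⊥-elim (¬t tt)
[]·-false {false} x ¬t = refl

[]·-zero : ∀ b → [ b ]· 0ℚ ≡ 0ℚ
[]·-zero true  = refl
[]·-zero false = refl

[]·-∧ : ∀ a b x → [ a ∧ b ]· x ≡ [ a ]· [ b ]· x
[]·-∧ true  b x = refl
[]·-∧ false b x = refl

[]·-*ˡ : ∀ b c x → [ b ]· (c * x) ≡ c * [ b ]· x
[]·-*ˡ true  c x = refl
[]·-*ˡ false c x = sym (*-zeroʳ c)

[]·-*ʳ : ∀ b c x → [ b ]· (x * c) ≡ [ b ]· x * c
[]·-*ʳ true  c x = refl
[]·-*ʳ false c x = sym (*-zeroˡ c)

[]·-nest : ∀ a b X Y → [ a ]· (X * [ b ]· Y) ≡ [ a ∧ b ]· (X * Y)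
[]·-nest false b     X Y = refl
[]·-nest true  true  X Y = refl
[]·-nest true  false X Y = *-zeroʳ X

[]·-nest² : ∀ a b c d X Y → [ a ]· (X * [ b ]· (Y * [ c ]· [ d ]· 1ℚ)) ≡ [ (a ∧ b) ∧ (c ∧ d) ]· (X * Y)
[]·-nest² false b     c     d     X Y = refl
[]·-nest² true  false c     d     X Y = *-zeroʳ X
[]·-nest² true  true  false d     X Y = trans (cong (X *_) (*-zeroʳ Y)) (*-zeroʳ X)
[]·-nest² true  true  true  false X Y = trans (cong (X *_) (*-zeroʳ Y)) (*-zeroʳ X)
[]·-nest² true  true  true  true  X Y = cong (X *_) (*-identityʳ Y)

[]·-∑ : ∀ {A : Set} b xs (f : A → ℚ) → [ b ]· ∑ xs f ≡ ∑ xs (λ x → [ b ]· f x)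
[]·-∑ true  xs f = refl
[]·-∑ false xs f = sym (∑-zero xs (λ _ → refl))

[]·-*-∑ : ∀ {A : Set} b W xs (f : A → ℚ) → [ b ]· (W * ∑ xs f) ≡ ∑ xs (λ x → [ b ]· (W * f x))
[]·-*-∑ b W xs f = trans (cong ([ b ]·_) (*-distribˡ-∑ W xs f)) ([]·-∑ b xs _)

∑<-indicator : ∀ n k (f : ℕ → ℚ) → k < n → ∑< n (λ x → [ k ≡ᵇ x ]· f x) ≡ f k
∑<-indicator (suc n) k f k<1+n with ℕ.m≤n⇒m<n∨m≡n (ℕ.≤-pred k<1+n)
... | inj₁ k<n = begin
  ∑< (suc n) (λ x → [ k ≡ᵇ x ]· f x)               ≡⟨ ∑<-suc n _ ⟩
  ∑< n (λ x → [ k ≡ᵇ x ]· f x) + [ k ≡ᵇ n ]· f n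
     ≡⟨ cong₂ _+_ (∑<-indicator n k f k<n) ([]·-false (f n) (λ t → ℕ.<-irrefl (ℕ.≡ᵇ⇒≡ k n t) k<n)) ⟩
  f k + 0ℚ                                         ≡⟨ +-identityʳ (f k) ⟩
  f k                                              ∎
  where open ≡-Reasoning
... | inj₂ refl = begin
  ∑< (suc k) (λ x → [ k ≡ᵇ x ]· f x)               ≡⟨ ∑<-suc k _ ⟩
  ∑< k (λ x → [ k ≡ᵇ x ]· f x) + [ k ≡ᵇ k ]· f k
     ≡⟨ cong₂ _+_ (∑<-cong k (λ x x<k → []·-false (f x) (λ t → ℕ.<-irrefl (sym (ℕ.≡ᵇ⇒≡ k x t)) x<k)))
                  ([]·-true (f k) (ℕ.≡⇒≡ᵇ k k refl)) ⟩
  ∑< k (λ _ → 0ℚ) + f k                             ≡⟨ cong (_+ f k) (∑-zero (upTo k) (λ _ → refl)) ⟩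
  0ℚ + f k                                         ≡⟨ +-identityˡ (f k) ⟩
  f k                                              ∎
  where open ≡-Reasoning

∑<-truncate : ∀ k e (f : ℕ → ℚ) → e < k → ∑< k (λ d → [ d ≤ᵇ e ]· f d) ≡ ∑< (suc e) f
∑<-truncate (suc k) e f e<1+k with ℕ.m≤n⇒m<n∨m≡n (ℕ.≤-pred e<1+k)
... | inj₁ e<k = begin
  ∑< (suc k) (λ d → [ d ≤ᵇ e ]· f d)               ≡⟨ ∑<-suc k _ ⟩
  ∑< k (λ d → [ d ≤ᵇ e ]· f d) + [ k ≤ᵇ e ]· f k
     ≡⟨ cong₂ _+_ (∑<-truncate k e f e<k) ([]·-false (f k) (λ t → ℕ.<⇒≱ e<k (ℕ.≤ᵇ⇒≤ k e t))) ⟩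
  ∑< (suc e) f + 0ℚ                                ≡⟨ +-identityʳ _ ⟩
  ∑< (suc e) f                                     ∎
  where open ≡-Reasoning
... | inj₂ refl = begin
  ∑< (suc e) (λ d → [ d ≤ᵇ e ]· f d)               ≡⟨ ∑<-suc e _ ⟩
  ∑< e (λ d → [ d ≤ᵇ e ]· f d) + [ e ≤ᵇ e ]· f e
     ≡⟨ cong₂ _+_ (∑<-cong e (λ d d<e → []·-true (f d) (ℕ.≤⇒≤ᵇ (ℕ.<⇒≤ d<e)))) ([]·-true (f e) (ℕ.≤⇒≤ᵇ (ℕ.≤-refl {e}))) ⟩
  ∑< e f + f e                                     ≡⟨ ∑<-suc e f ⟨
  ∑< (suc e) f                                     ∎
  where open ≡-Reasoning

trichotomy-split : ∀ m n x → x ≡ [ n <ᵇ m ]· x + [ m <ᵇ n ]· x + [ m ≡ᵇ n ]· x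
trichotomy-split m n x with ℕ.<-cmp m n
... | tri< m<n _ n≮m = sym (trans (cong₂ _+_ (cong₂ _+_ ([]·-false x (n≮m ∘ ℕ.<ᵇ⇒< n m)) ([]·-true x (ℕ.<⇒<ᵇ m<n)))
                                             ([]·-false x (λ t → ℕ.<-irrefl (ℕ.≡ᵇ⇒≡ m n t) m<n)))
                                  (trans (+-identityʳ (0ℚ + x)) (+-identityˡ x)))
... | tri≈ _ refl _   = sym (trans (cong₂ _+_ (cong₂ _+_ ([]·-false x m≮m) ([]·-false x m≮m)) ([]·-true x (ℕ.≡⇒≡ᵇ m m refl)))
                                  (trans (cong (_+ x) (+-identityˡ 0ℚ)) (+-identityˡ x)))
  where m≮m = λ t → ℕ.<-irrefl refl (ℕ.<ᵇ⇒< m m t)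
... | tri> m≮n _ n<m = sym (trans (cong₂ _+_ (cong₂ _+_ ([]·-true x (ℕ.<⇒<ᵇ n<m)) ([]·-false x (m≮n ∘ ℕ.<ᵇ⇒< m n)))
                                             ([]·-false x (λ t → ℕ.<-irrefl (sym (ℕ.≡ᵇ⇒≡ m n t)) n<m)))
                                  (trans (+-identityʳ (x + 0ℚ)) (+-identityʳ x)))

-- Formal ℚ-linear combinations, as lists of (coefficient, object) pairs

combine : {A : Set} → List (ℚ × A) → (A → ℚ) → ℚ
combine L f = ∑ L (λ t → proj₁ t * f (proj₂ t))

scale : {A : Set} → ℚ → List (ℚ × A) → List (ℚ × A)
scale q = map (λ t → q * proj₁ t , proj₂ t)

_>>=ₗ_ : {A B : Set} → List (ℚ × A) → (A → List (ℚ × B)) → List (ℚ × B)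
L >>=ₗ g = concatMap (λ t → scale (proj₁ t) (g (proj₂ t))) L

_⊗ₗ_ : {A B : Set} → List (ℚ × A) → List (ℚ × B) → List (ℚ × (A × B))
L ⊗ₗ L' = L >>=ₗ (λ a → map (map₂ (a ,_)) L')

module _ {A : Set} where

  combine-cong : ∀ L {f g : A → ℚ} → (∀ a → f a ≡ g a) → combine L f ≡ combine L g
  combine-cong L eq = ∑-cong L (λ t → cong (proj₁ t *_) (eq (proj₂ t)))

  combine-zero : ∀ L {f : A → ℚ} → (∀ a → f a ≡ 0ℚ) → combine L f ≡ 0ℚ
  combine-zero L eq = ∑-zero L (λ t → trans (cong (proj₁ t *_) (eq (proj₂ t))) (*-zeroʳ (proj₁ t)))

  combine-++ : ∀ L L' (f : A → ℚ) → combine (L ++ L') f ≡ combine L f + combine L' f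
  combine-++ L L' f = ∑-++ L L' _

  combine-map₂ : ∀ {B : Set} (g : B → A) L (f : A → ℚ) → combine (map (map₂ g) L) f ≡ combine L (f ∘ g)
  combine-map₂ g L f = ∑-map (map₂ g) L _

  combine-scale : ∀ q L (f : A → ℚ) → combine (scale q L) f ≡ q * combine L f
  combine-scale q L f = begin
    combine (scale q L) f                      ≡⟨ ∑-map _ L _ ⟩
    ∑ L (λ t → q * proj₁ t * f (proj₂ t))       ≡⟨ ∑-cong L (λ t → *-assoc q (proj₁ t) (f (proj₂ t))) ⟩
    ∑ L (λ t → q * (proj₁ t * f (proj₂ t)))     ≡⟨ *-distribˡ-∑ q L _ ⟨
    q * combine L f                            ∎
    where open ≡-Reasoning

  *-distribˡ-combine : ∀ c L (f : A → ℚ) → c * combine L f ≡ combine L (λ a → c * f a)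
  *-distribˡ-combine c L f = trans (*-distribˡ-∑ c L _) (∑-cong L (λ t → swap c (proj₁ t) (f (proj₂ t))))
    where swap : ∀ c q x → c * (q * x) ≡ q * (c * x)
          swap = solve-∀ ℚ-ring

  []·-*-combine : ∀ b W L (f : A → ℚ) → [ b ]· (W * combine L f) ≡ combine L (λ a → [ b ]· (W * f a))
  []·-*-combine true  W L f = *-distribˡ-combine W L f
  []·-*-combine false W L f = sym (combine-zero L (λ _ → refl))

  []·-*-[]·-combine : ∀ r p P L (E : A → ℚ) H →
    [ r ]· (P * ([ p ]· combine L E * H)) ≡ combine L (λ a → [ r ∧ p ]· ((P * E a) * H))
  []·-*-[]·-combine false p     P L E H = sym (combine-zero L (λ _ → refl))
  []·-*-[]·-combine true  false P L E H =
    trans (trans (cong (P *_) (*-zeroˡ H)) (*-zeroʳ P)) (sym (combine-zero L (λ _ → refl)))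
  []·-*-[]·-combine true  true  P L E H = begin
    P * (combine L E * H)                 ≡⟨ swap P (combine L E) H ⟩
    (P * H) * combine L E                 ≡⟨ *-distribˡ-combine (P * H) L E ⟩
    combine L (λ a → (P * H) * E a)       ≡⟨ combine-cong L (λ a → swap' P H (E a)) ⟩
    combine L (λ a → (P * E a) * H)       ∎
    where
    open ≡-Reasoning
    swap : ∀ P C H → P * (C * H) ≡ (P * H) * C
    swap = solve-∀ ℚ-ring
    swap' : ∀ P H E → (P * H) * E ≡ (P * E) * H
    swap' = solve-∀ ℚ-ring

combine->>= : ∀ {A B : Set} (L : List (ℚ × A)) (g : A → List (ℚ × B)) f →
  combine (L >>=ₗ g) f ≡ combine L (λ a → combine (g a) f)
combine->>= L g f = trans (∑-concatMap _ L _) (∑-cong L (λ t → combine-scale (proj₁ t) (g (proj₂ t)) f))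

combine-⊗ : ∀ {A B : Set} (L : List (ℚ × A)) (L' : List (ℚ × B)) f →
  combine (L ⊗ₗ L') f ≡ combine L (λ a → combine L' (λ b → f (a , b)))
combine-⊗ L L' f = trans (combine->>= L _ f) (combine-cong L (λ a → combine-map₂ (a ,_) L' f))

All->>=ₗ : ∀ {A B : Set} {P : A → Set} {Q : B → Set} {L : List (ℚ × A)} (g : A → List (ℚ × B)) →
  All (P ∘ proj₂) L → (∀ {a} → P a → All (Q ∘ proj₂) (g a)) → All (Q ∘ proj₂) (L >>=ₗ g)
All->>=ₗ g ps h = concat⁺ (map⁺ (All.map (λ p → map⁺ (h p)) ps))

All-⊗ₗ : ∀ {A B : Set} {P : A → Set} {Q : B → Set} {L : List (ℚ × A)} {L' : List (ℚ × B)} →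
  All (P ∘ proj₂) L → All (Q ∘ proj₂) L' → All ((λ ab → P (proj₁ ab) × Q (proj₂ ab)) ∘ proj₂) (L ⊗ₗ L')
All-⊗ₗ ps qs = All->>=ₗ _ ps (λ p → map⁺ (All.map (p ,_) qs))

-- Polynomials in the binomial and in the power basis

Combination : Set
Combination = List (ℚ × ℕ)

evalIn : (ℕ → ℕ → ℚ) → Combination → ℕ → ℚ
evalIn basis L e = combine L (λ j → basis j e)

binomialBasis powerBasis : ℕ → ℕ → ℚ
binomialBasis k e = fromℕℚ (e C k)
powerBasis    j e = fromℕℚ (e ^ j)

-- in the binomial basis `raise` is the antidifference Σ_{d<e}, in the power basis multiplication by e
raise : Combination → Combination
raise = map (λ t → proj₁ t , suc (proj₂ t))

n*nCk≡[k+1]*nC[k+1]+k*nCk : ∀ n k → n ℕ.* (n C k) ≡ suc k ℕ.* (n C suc k) ℕ.+ k ℕ.* (n C k)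
n*nCk≡[k+1]*nC[k+1]+k*nCk zero    zero    = refl
n*nCk≡[k+1]*nC[k+1]+k*nCk zero    (suc k) = sym (cong₂ ℕ._+_ (ℕ.*-zeroʳ (suc (suc k))) (ℕ.*-zeroʳ (suc k)))
n*nCk≡[k+1]*nC[k+1]+k*nCk (suc n) zero    = begin
  suc n ℕ.* 1                 ≡⟨ ℕ.*-identityʳ (suc n) ⟩
  suc n                       ≡⟨ nC1≡n (suc n) ⟨
  suc n C 1                   ≡⟨ ℕ.+-identityʳ (suc n C 1) ⟨
  suc n C 1 ℕ.+ 0             ≡⟨ cong (ℕ._+ 0) (ℕ.*-identityˡ (suc n C 1)) ⟨
  1 ℕ.* (suc n C 1) ℕ.+ 0     ∎
  where open ≡-Reasoning
n*nCk≡[k+1]*nC[k+1]+k*nCk (suc n) (suc k) = begin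
  suc n ℕ.* (suc n C suc k)
    ≡⟨ cong (suc n ℕ.*_) (pascal k) ⟨
  suc n ℕ.* (n C k ℕ.+ n C suc k)
    ≡⟨ expand n (n C k) (n C suc k) ⟩
  n ℕ.* (n C k) ℕ.+ n ℕ.* (n C suc k) ℕ.+ n C k ℕ.+ n C suc k
    ≡⟨ cong₂ (λ a b → a ℕ.+ b ℕ.+ n C k ℕ.+ n C suc k) (n*nCk≡[k+1]*nC[k+1]+k*nCk n k) (n*nCk≡[k+1]*nC[k+1]+k*nCk n (suc k)) ⟩
  suc k ℕ.* (n C suc k) ℕ.+ k ℕ.* (n C k) ℕ.+ (suc (suc k) ℕ.* (n C suc (suc k)) ℕ.+ suc k ℕ.* (n C suc k)) ℕ.+ n C k ℕ.+ n C suc k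
    ≡⟨ regroup k (n C k) (n C suc k) (n C suc (suc k)) ⟩
  suc (suc k) ℕ.* (n C suc k ℕ.+ n C suc (suc k)) ℕ.+ suc k ℕ.* (n C k ℕ.+ n C suc k)
    ≡⟨ cong₂ (λ a b → suc (suc k) ℕ.* a ℕ.+ suc k ℕ.* b) (pascal (suc k)) (pascal k) ⟩
  suc (suc k) ℕ.* (suc n C suc (suc k)) ℕ.+ suc k ℕ.* (suc n C suc k) ∎
  where
  open ≡-Reasoning
  pascal : ∀ k → n C k ℕ.+ n C suc k ≡ suc n C suc k
  pascal = nCk+nC[k+1]≡[n+1]C[k+1] n
  expand : ∀ n a b → suc n ℕ.* (a ℕ.+ b) ≡ n ℕ.* a ℕ.+ n ℕ.* b ℕ.+ a ℕ.+ b
  expand = ℕ-Solver.solve-∀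
  regroup : ∀ k a b c → suc k ℕ.* b ℕ.+ k ℕ.* a ℕ.+ (suc (suc k) ℕ.* c ℕ.+ suc k ℕ.* b) ℕ.+ a ℕ.+ b
                        ≡ suc (suc k) ℕ.* (b ℕ.+ c) ℕ.+ suc k ℕ.* (a ℕ.+ b)
  regroup = ℕ-Solver.solve-∀

∑<-binomial : ∀ e k → ∑< e (binomialBasis k) ≡ binomialBasis (suc k) e
∑<-binomial zero    k = refl
∑<-binomial (suc e) k = begin
  ∑< (suc e) (binomialBasis k)                        ≡⟨ ∑<-suc e (binomialBasis k) ⟩
  ∑< e (binomialBasis k) + binomialBasis k e          ≡⟨ cong (_+ binomialBasis k e) (∑<-binomial e k) ⟩
  binomialBasis (suc k) e + binomialBasis k e         ≡⟨ +-comm (binomialBasis (suc k) e) (binomialBasis k e) ⟩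
  binomialBasis k e + binomialBasis (suc k) e         ≡⟨ fromℕℚ-+ (e C k) (e C suc k) ⟨
  fromℕℚ (e C k ℕ.+ e C suc k)                        ≡⟨ cong fromℕℚ (nCk+nC[k+1]≡[n+1]C[k+1] e k) ⟩
  binomialBasis (suc k) (suc e)                       ∎
  where open ≡-Reasoning

arg*binomialBasis : ∀ e k → fromℕℚ (suc k) * binomialBasis (suc k) e + fromℕℚ k * binomialBasis k e ≡ fromℕℚ e * binomialBasis k e
arg*binomialBasis e k = begin
  fromℕℚ (suc k) * binomialBasis (suc k) e + fromℕℚ k * binomialBasis k e
    ≡⟨ cong₂ _+_ (fromℕℚ-* (suc k) (e C suc k)) (fromℕℚ-* k (e C k)) ⟨
  fromℕℚ (suc k ℕ.* (e C suc k)) + fromℕℚ (k ℕ.* (e C k))  ≡⟨ fromℕℚ-+ (suc k ℕ.* (e C suc k)) (k ℕ.* (e C k)) ⟨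
  fromℕℚ (suc k ℕ.* (e C suc k) ℕ.+ k ℕ.* (e C k))       ≡⟨ cong fromℕℚ (n*nCk≡[k+1]*nC[k+1]+k*nCk e k) ⟨
  fromℕℚ (e ℕ.* (e C k))                                 ≡⟨ fromℕℚ-* e (e C k) ⟩
  fromℕℚ e * binomialBasis k e                           ∎
  where open ≡-Reasoning

timesArg : Combination → Combination
timesArg = concatMap (λ t → (proj₁ t * fromℕℚ (suc (proj₂ t)) , suc (proj₂ t))
                          ∷ (proj₁ t * fromℕℚ (proj₂ t) , proj₂ t) ∷ [])

evalIn-timesArg : ∀ L e → evalIn binomialBasis (timesArg L) e ≡ fromℕℚ e * evalIn binomialBasis L e
evalIn-timesArg L e = begin
  evalIn binomialBasis (timesArg L) e                ≡⟨ ∑-concatMap _ L _ ⟩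
  ∑ L (λ t → (proj₁ t * K⁺ t) * B⁺ t + ((proj₁ t * K t) * B t + 0ℚ))
    ≡⟨ ∑-cong L (λ t → trans (regroup (proj₁ t) (K⁺ t) (B⁺ t) (K t) (B t))
                              (cong (proj₁ t *_) (arg*binomialBasis e (proj₂ t)))) ⟩
  ∑ L (λ t → proj₁ t * (fromℕℚ e * B t))             ≡⟨ ∑-cong L (λ t → swap (proj₁ t) (fromℕℚ e) (B t)) ⟩
  ∑ L (λ t → fromℕℚ e * (proj₁ t * B t))             ≡⟨ *-distribˡ-∑ (fromℕℚ e) L _ ⟨
  fromℕℚ e * evalIn binomialBasis L e                ∎
  where
  open ≡-Reasoning
  K K⁺ B B⁺ : ℚ × ℕ → ℚ
  K  t = fromℕℚ (proj₂ t)
  K⁺ t = fromℕℚ (suc (proj₂ t))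
  B  t = binomialBasis (proj₂ t) e
  B⁺ t = binomialBasis (suc (proj₂ t)) e
  regroup : ∀ c a x b y → (c * a) * x + ((c * b) * y + 0ℚ) ≡ c * (a * x + b * y)
  regroup = solve-∀ ℚ-ring
  swap : ∀ c a x → c * (a * x) ≡ a * (c * x)
  swap = solve-∀ ℚ-ring

∑<-evalIn-binomial : ∀ L e → ∑< e (evalIn binomialBasis L) ≡ evalIn binomialBasis (raise L) e
∑<-evalIn-binomial L e = begin
  ∑< e (λ d → ∑ L (λ t → proj₁ t * binomialBasis (proj₂ t) d))   ≡⟨ ∑-comm (upTo e) L _ ⟩
  ∑ L (λ t → ∑< e (λ d → proj₁ t * binomialBasis (proj₂ t) d))   ≡⟨ ∑-cong L (λ t → *-distribˡ-∑ (proj₁ t) (upTo e) _) ⟨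
  ∑ L (λ t → proj₁ t * ∑< e (binomialBasis (proj₂ t)))           ≡⟨ ∑-cong L (λ t → cong (proj₁ t *_) (∑<-binomial e (proj₂ t))) ⟩
  ∑ L (λ t → proj₁ t * binomialBasis (suc (proj₂ t)) e)          ≡⟨ ∑-map _ L _ ⟨
  evalIn binomialBasis (raise L) e                                ∎
  where open ≡-Reasoning

evalIn-power-raise : ∀ L e → evalIn powerBasis (raise L) e ≡ fromℕℚ e * evalIn powerBasis L e
evalIn-power-raise L e = begin
  evalIn powerBasis (raise L) e                          ≡⟨ ∑-map _ L _ ⟩
  ∑ L (λ t → proj₁ t * fromℕℚ (e ℕ.* e ^ proj₂ t))       ≡⟨ ∑-cong L (λ t → trans (cong (proj₁ t *_) (fromℕℚ-* e (e ^ proj₂ t)))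
                                                                             (swap (proj₁ t) (fromℕℚ e) _)) ⟩
  ∑ L (λ t → fromℕℚ e * (proj₁ t * powerBasis (proj₂ t) e)) ≡⟨ *-distribˡ-∑ (fromℕℚ e) L _ ⟨
  fromℕℚ e * evalIn powerBasis L e                       ∎
  where
  open ≡-Reasoning
  swap : ∀ c a x → c * (a * x) ≡ a * (c * x)
  swap = solve-∀ ℚ-ring

powerInBinomial : ℕ → Combination
powerInBinomial zero    = (1ℚ , 0) ∷ []
powerInBinomial (suc b) = timesArg (powerInBinomial b)

evalIn-powerInBinomial : ∀ b d → evalIn binomialBasis (powerInBinomial b) d ≡ fromℕℚ (d ^ b)
evalIn-powerInBinomial zero    d = refl
evalIn-powerInBinomial (suc b) d = begin
  evalIn binomialBasis (timesArg (powerInBinomial b)) d   ≡⟨ evalIn-timesArg (powerInBinomial b) d ⟩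
  fromℕℚ d * evalIn binomialBasis (powerInBinomial b) d   ≡⟨ cong (fromℕℚ d *_) (evalIn-powerInBinomial b d) ⟩
  fromℕℚ d * fromℕℚ (d ^ b)                              ≡⟨ fromℕℚ-* d (d ^ b) ⟨
  fromℕℚ (d ^ suc b)                                     ∎
  where open ≡-Reasoning

convolution<-summand-step : ∀ b b' e d → d ≤ e →
  fromℕℚ e * fromℕℚ (d ^ b ℕ.* (e ∸ d) ^ b') + - 1ℚ * fromℕℚ (d ^ suc b ℕ.* (e ∸ d) ^ b') ≡ fromℕℚ (d ^ b ℕ.* (e ∸ d) ^ suc b')
convolution<-summand-step b b' e d d≤e = begin
  fromℕℚ e * fromℕℚ (d ^ b ℕ.* (e ∸ d) ^ b') + - 1ℚ * fromℕℚ (d ^ suc b ℕ.* (e ∸ d) ^ b')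
    ≡⟨ cong₂ (λ x y → x * y + - 1ℚ * fromℕℚ (d ^ suc b ℕ.* (e ∸ d) ^ b')) e≡ (fromℕℚ-* (d ^ b) ((e ∸ d) ^ b')) ⟩
  (E + D) * (P * P') + - 1ℚ * fromℕℚ (d ^ suc b ℕ.* (e ∸ d) ^ b')
    ≡⟨ cong (λ y → (E + D) * (P * P') + - 1ℚ * y) (trans (fromℕℚ-* (d ^ suc b) ((e ∸ d) ^ b')) (cong (_* P') (fromℕℚ-* d (d ^ b)))) ⟩
  (E + D) * (P * P') + - 1ℚ * ((D * P) * P')        ≡⟨ ring E D P P' ⟩
  P * (E * P')                                      ≡⟨ cong (P *_) (fromℕℚ-* (e ∸ d) ((e ∸ d) ^ b')) ⟨
  P * fromℕℚ ((e ∸ d) ^ suc b')                     ≡⟨ fromℕℚ-* (d ^ b) ((e ∸ d) ^ suc b') ⟨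
  fromℕℚ (d ^ b ℕ.* (e ∸ d) ^ suc b')               ∎
  where
  open ≡-Reasoning
  E = fromℕℚ (e ∸ d)
  D = fromℕℚ d
  P = fromℕℚ (d ^ b)
  P' = fromℕℚ ((e ∸ d) ^ b')
  e≡ : fromℕℚ e ≡ E + D
  e≡ = trans (cong fromℕℚ (sym (ℕ.m∸n+n≡m d≤e))) (fromℕℚ-+ (e ∸ d) d)
  ring : ∀ E D P P' → (E + D) * (P * P') + - 1ℚ * ((D * P) * P') ≡ P * (E * P')
  ring = solve-∀ ℚ-ring

convolution< : ℕ → ℕ → ℕ → ℚ
convolution< b b' e = ∑< e (λ d → fromℕℚ (d ^ b ℕ.* (e ∸ d) ^ b'))

-- Σ_{d<e} d^b (e−d)^(b'+1) = e · Σ_{d<e} d^b (e−d)^b' − Σ_{d<e} d^(b+1) (e−d)^b'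
convolution<InBinomial : ℕ → ℕ → Combination
convolution<InBinomial b zero     = raise (powerInBinomial b)
convolution<InBinomial b (suc b') = timesArg (convolution<InBinomial b b') ++ scale (- 1ℚ) (convolution<InBinomial (suc b) b')

evalIn-convolution<InBinomial : ∀ b b' e → evalIn binomialBasis (convolution<InBinomial b b') e ≡ convolution< b b' e
evalIn-convolution<InBinomial b zero e = begin
  evalIn binomialBasis (raise (powerInBinomial b)) e   ≡⟨ ∑<-evalIn-binomial (powerInBinomial b) e ⟨
  ∑< e (evalIn binomialBasis (powerInBinomial b))      ≡⟨ ∑-cong (upTo e) (λ d → trans (evalIn-powerInBinomial b d)
                                                                                    (cong fromℕℚ (sym (ℕ.*-identityʳ (d ^ b))))) ⟩
  convolution< b 0 e                                   ∎
  where open ≡-Reasoning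
evalIn-convolution<InBinomial b (suc b') e = begin
  evalIn binomialBasis (timesArg Q ++ scale (- 1ℚ) Q⁺) e
    ≡⟨ combine-++ (timesArg Q) (scale (- 1ℚ) Q⁺) _ ⟩
  evalIn binomialBasis (timesArg Q) e + evalIn binomialBasis (scale (- 1ℚ) Q⁺) e
    ≡⟨ cong₂ _+_ (evalIn-timesArg Q e) (combine-scale (- 1ℚ) Q⁺ _) ⟩
  fromℕℚ e * evalIn binomialBasis Q e + - 1ℚ * evalIn binomialBasis Q⁺ e
    ≡⟨ cong₂ (λ x y → fromℕℚ e * x + - 1ℚ * y) (evalIn-convolution<InBinomial b b' e) (evalIn-convolution<InBinomial (suc b) b' e) ⟩
  fromℕℚ e * convolution< b b' e + - 1ℚ * convolution< (suc b) b' e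
    ≡⟨ cong₂ _+_ (*-distribˡ-∑ (fromℕℚ e) (upTo e) (summand b b')) (*-distribˡ-∑ (- 1ℚ) (upTo e) (summand (suc b) b')) ⟩
  ∑< e (λ d → fromℕℚ e * summand b b' d) + ∑< e (λ d → - 1ℚ * summand (suc b) b' d)
    ≡⟨ ∑-+ (upTo e) (λ d → fromℕℚ e * summand b b' d) (λ d → - 1ℚ * summand (suc b) b' d) ⟨
  ∑< e (λ d → fromℕℚ e * summand b b' d + - 1ℚ * summand (suc b) b' d)
    ≡⟨ ∑<-cong e (λ d d<e → convolution<-summand-step b b' e d (ℕ.<⇒≤ d<e)) ⟩
  convolution< b (suc b') e ∎
  where
  open ≡-Reasoning
  Q Q⁺ : Combination
  Q  = convolution<InBinomial b b'
  Q⁺ = convolution<InBinomial (suc b) b'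
  summand : ℕ → ℕ → ℕ → ℚ
  summand b b' d = fromℕℚ (d ^ b ℕ.* (e ∸ d) ^ b')

1/suc : ℕ → ℚ
1/suc k = ℤ.+ 1 ℚ./ suc k

1/suc*suc : ∀ k → 1/suc k * fromℕℚ (suc k) ≡ 1ℚ
1/suc*suc k = toℚᵘ-injective (begin
  toℚᵘ (1/suc k * fromℕℚ (suc k))                        ≈⟨ toℚᵘ-homo-* (1/suc k) (fromℕℚ (suc k)) ⟩
  toℚᵘ (1/suc k) ℚᵘ.* toℚᵘ (fromℕℚ (suc k))              ≈⟨ ℚᵘ.*-cong (toℚᵘ-fromℚᵘ (ℚᵘ.mkℚᵘ (ℤ.+ 1) k)) (toℚᵘ-fromℚᵘ (ℕ→ℚᵘ (suc k))) ⟩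
  ℚᵘ.mkℚᵘ (ℤ.+ 1) k ℚᵘ.* ℕ→ℚᵘ (suc k)                    ≈⟨ ℚᵘ.*≡* (lemma (ℤ.+ suc k)) ⟩
  ℕ→ℚᵘ 1                                                 ≈⟨ toℚᵘ-fromℚᵘ (ℕ→ℚᵘ 1) ⟨
  toℚᵘ 1ℚ                                                ∎)
  where
  open ℚᵘ.≃-Reasoning
  lemma : ∀ x → (ℤ.1ℤ ℤ.* x) ℤ.* ℤ.1ℤ ≡ ℤ.1ℤ ℤ.* (x ℤ.* ℤ.1ℤ)
  lemma = ℤ-Solver.solve-∀

-- (k+1) C(e, k+1) = e C(e, k) − k C(e, k)
binomialInPowers : ℕ → Combination
binomialInPowers zero    = (1ℚ , 0) ∷ []
binomialInPowers (suc k) = scale (1/suc k) (raise (binomialInPowers k) ++ scale (- fromℕℚ k) (binomialInPowers k))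

evalIn-binomialInPowers : ∀ k e → evalIn powerBasis (binomialInPowers k) e ≡ binomialBasis k e
evalIn-binomialInPowers zero    e = refl
evalIn-binomialInPowers (suc k) e = begin
  evalIn powerBasis (scale (1/suc k) (raise P ++ scale (- K) P)) e
    ≡⟨ combine-scale (1/suc k) (raise P ++ scale (- K) P) _ ⟩
  1/suc k * evalIn powerBasis (raise P ++ scale (- K) P) e
    ≡⟨ cong (1/suc k *_) (combine-++ (raise P) (scale (- K) P) _) ⟩
  1/suc k * (evalIn powerBasis (raise P) e + evalIn powerBasis (scale (- K) P) e)
    ≡⟨ cong₂ (λ x y → 1/suc k * (x + y)) (evalIn-power-raise P e) (combine-scale (- K) P _) ⟩
  1/suc k * (fromℕℚ e * evalIn powerBasis P e + - K * evalIn powerBasis P e)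
    ≡⟨ cong (λ x → 1/suc k * (fromℕℚ e * x + - K * x)) (evalIn-binomialInPowers k e) ⟩
  1/suc k * (fromℕℚ e * binomialBasis k e + - K * binomialBasis k e)
    ≡⟨ cong (λ x → 1/suc k * (x + - K * binomialBasis k e)) (arg*binomialBasis e k) ⟨
  1/suc k * (fromℕℚ (suc k) * binomialBasis (suc k) e + K * binomialBasis k e + - K * binomialBasis k e)
    ≡⟨ cancel (1/suc k) (fromℕℚ (suc k)) (binomialBasis (suc k) e) K (binomialBasis k e) ⟩
  (1/suc k * fromℕℚ (suc k)) * binomialBasis (suc k) e
    ≡⟨ cong (_* binomialBasis (suc k) e) (1/suc*suc k) ⟩
  1ℚ * binomialBasis (suc k) e
    ≡⟨ *-identityˡ (binomialBasis (suc k) e) ⟩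
  binomialBasis (suc k) e ∎
  where
  open ≡-Reasoning
  P = binomialInPowers k
  K = fromℕℚ k
  cancel : ∀ i s c k x → i * (s * c + k * x + - k * x) ≡ (i * s) * c
  cancel = solve-∀ ℚ-ring

toPowers : Combination → Combination
toPowers L = L >>=ₗ binomialInPowers

evalIn-toPowers : ∀ L e → evalIn powerBasis (toPowers L) e ≡ evalIn binomialBasis L e
evalIn-toPowers L e = trans (combine->>= L binomialInPowers _) (combine-cong L (λ k → evalIn-binomialInPowers k e))

dropConstant : Combination → Combination
dropConstant []                  = []
dropConstant ((c , zero)  ∷ L)   = dropConstant L
dropConstant ((c , suc j) ∷ L)   = (c , suc j) ∷ dropConstant L

evalIn-dropConstant : ∀ L e → evalIn powerBasis L e ≡ evalIn powerBasis L 0 + evalIn powerBasis (dropConstant L) e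
evalIn-dropConstant []                e = sym (+-identityˡ 0ℚ)
evalIn-dropConstant ((c , zero)  ∷ L) e =
  trans (cong (c * 1ℚ +_) (evalIn-dropConstant L e)) (sym (+-assoc (c * 1ℚ) _ _))
evalIn-dropConstant ((c , suc j) ∷ L) e =
  trans (cong (c * powerBasis (suc j) e +_) (evalIn-dropConstant L e))
        (regroup c (powerBasis (suc j) e) (evalIn powerBasis L 0) (evalIn powerBasis (dropConstant L) e))
  where
  regroup : ∀ c p x y → c * p + (x + y) ≡ (c * 0ℚ + x) + (c * p + y)
  regroup = solve-∀ ℚ-ring

convolution<-expansion : ∀ b b' e → convolution< b b' e ≡ evalIn powerBasis (dropConstant (toPowers (convolution<InBinomial b b'))) e
convolution<-expansion b b' e = begin
  convolution< b b' e                                ≡⟨ evalIn-convolution<InBinomial b b' e ⟨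
  evalIn binomialBasis Q e                           ≡⟨ evalIn-toPowers Q e ⟨
  evalIn powerBasis (toPowers Q) e                   ≡⟨ evalIn-dropConstant (toPowers Q) e ⟩
  evalIn powerBasis (toPowers Q) 0 + R               ≡⟨ cong (_+ R) (trans (evalIn-toPowers Q 0) (evalIn-convolution<InBinomial b b' 0)) ⟩
  0ℚ + R                                             ≡⟨ +-identityˡ R ⟩
  R                                                  ∎
  where
  open ≡-Reasoning
  Q = convolution<InBinomial b b'
  R = evalIn powerBasis (dropConstant (toPowers Q)) e

convolution : ℕ → ℕ → ℕ → ℚ
convolution b b' e = ∑< (suc e) (λ d → [ (0 <ᵇ d) ∧ (0 <ᵇ (e ∸ d)) ]· fromℕℚ (d ^ b ℕ.* (e ∸ d) ^ b'))

convolution-suc : ∀ b b' e → convolution b b' (suc e) ≡ convolution< b b' (suc e) + - fromℕℚ (0 ^ b ℕ.* suc e ^ b')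
convolution-suc b b' e = begin
  convolution b b' (suc e)                            ≡⟨ ∑<-suc (suc e) φ ⟩
  ∑< (suc e) φ + φ (suc e)                            ≡⟨ cong₂ _+_ (∑<-suc-shift e φ) φ[1+e]≡0 ⟩
  0ℚ + ∑< e (φ ∘ suc) + 0ℚ                            ≡⟨ cong (λ x → 0ℚ + x + 0ℚ) (∑<-cong e inner) ⟩
  0ℚ + ∑< e (summand ∘ suc) + 0ℚ                      ≡⟨ regroup (∑< e (summand ∘ suc)) (summand 0) ⟩
  summand 0 + ∑< e (summand ∘ suc) + - summand 0      ≡⟨ cong (_+ - summand 0) (∑<-suc-shift e summand) ⟨
  convolution< b b' (suc e) + - summand 0             ∎
  where
  open ≡-Reasoning
  summand : ℕ → ℚ
  summand d = fromℕℚ (d ^ b ℕ.* (suc e ∸ d) ^ b')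
  φ : ℕ → ℚ
  φ d = [ (0 <ᵇ d) ∧ (0 <ᵇ (suc e ∸ d)) ]· summand d
  φ[1+e]≡0 : φ (suc e) ≡ 0ℚ
  φ[1+e]≡0 = []·-false (summand (suc e)) (λ t → subst (T ∘ (0 <ᵇ_)) (ℕ.n∸n≡0 e) (proj₂ (T-∧⁻ (0 <ᵇ suc e) t)))
  inner : ∀ d → d < e → φ (suc d) ≡ summand (suc d)
  inner d d<e = []·-true (summand (suc d)) (ℕ.<⇒<ᵇ (ℕ.m<n⇒0<n∸m d<e))
  regroup : ∀ S Z → 0ℚ + S + 0ℚ ≡ Z + S + - Z
  regroup = solve-∀ ℚ-ring

-- convolution< also counts the summand 0^b e^b' with d = 0, which is excluded from convolution
convolutionInPowers : ℕ → ℕ → Combination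
convolutionInPowers b b' = dropConstant (toPowers (convolution<InBinomial b b')) ++ (- fromℕℚ (0 ^ b) , b') ∷ []

convolution-expansion : ∀ b b' e → convolution b b' e ≡ [ 0 <ᵇ e ]· evalIn powerBasis (convolutionInPowers b b') e
convolution-expansion b b' zero    = refl
convolution-expansion b b' (suc e) = begin
  convolution b b' (suc e)                                   ≡⟨ convolution-suc b b' e ⟩
  convolution< b b' (suc e) + - fromℕℚ (0 ^ b ℕ.* suc e ^ b')   ≡⟨ cong₂ (λ x y → x + - y) (convolution<-expansion b b' (suc e))
                                                                                          (fromℕℚ-* (0 ^ b) (suc e ^ b')) ⟩
  R + - (fromℕℚ (0 ^ b) * powerBasis b' (suc e))             ≡⟨ cong (R +_) (negate-product (fromℕℚ (0 ^ b)) (powerBasis b' (suc e))) ⟩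
  R + (- fromℕℚ (0 ^ b) * powerBasis b' (suc e) + 0ℚ)        ≡⟨ combine-++ (dropConstant (toPowers (convolution<InBinomial b b')))
                                                                           ((- fromℕℚ (0 ^ b) , b') ∷ []) _ ⟨
  evalIn powerBasis (convolutionInPowers b b') (suc e)       ∎
  where
  open ≡-Reasoning
  R = evalIn powerBasis (dropConstant (toPowers (convolution<InBinomial b b'))) (suc e)
  negate-product : ∀ x y → - (x * y) ≡ - x * y + 0ℚ
  negate-product = solve-∀ ℚ-ring

Degree≤ : ℕ → Combination → Set
Degree≤ D = All (λ t → proj₂ t ≤ D)

Degree≤-mono : ∀ {D D' L} → D ≤ D' → Degree≤ D L → Degree≤ D' L
Degree≤-mono D≤D' = All.map (λ j≤D → ℕ.≤-trans j≤D D≤D')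

scale-degree : ∀ {D} q L → Degree≤ D L → Degree≤ D (scale q L)
scale-degree q L = map⁺

raise-degree : ∀ {D} L → Degree≤ D L → Degree≤ (suc D) (raise L)
raise-degree L = map⁺ ∘ All.map s≤s

timesArg-degree : ∀ {D} L → Degree≤ D L → Degree≤ (suc D) (timesArg L)
timesArg-degree L = concat⁺ ∘ map⁺ ∘ All.map (λ k≤D → s≤s k≤D ∷ ℕ.m≤n⇒m≤1+n k≤D ∷ [])

powerInBinomial-degree : ∀ b → Degree≤ b (powerInBinomial b)
powerInBinomial-degree zero    = z≤n ∷ []
powerInBinomial-degree (suc b) = timesArg-degree (powerInBinomial b) (powerInBinomial-degree b)

convolution<InBinomial-degree : ∀ b b' → Degree≤ (suc (b ℕ.+ b')) (convolution<InBinomial b b')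
convolution<InBinomial-degree b zero     =
  Degree≤-mono (s≤s (ℕ.m≤m+n b 0)) (raise-degree (powerInBinomial b) (powerInBinomial-degree b))
convolution<InBinomial-degree b (suc b') = Degree≤-mono (ℕ.≤-reflexive (cong suc (sym (ℕ.+-suc b b'))))
  (++⁺ (timesArg-degree _ (convolution<InBinomial-degree b b'))
       (scale-degree (- 1ℚ) _ (convolution<InBinomial-degree (suc b) b')))

binomialInPowers-degree : ∀ k → Degree≤ k (binomialInPowers k)
binomialInPowers-degree zero    = z≤n ∷ []
binomialInPowers-degree (suc k) = scale-degree (1/suc k) _
  (++⁺ (raise-degree _ (binomialInPowers-degree k))
       (scale-degree (- fromℕℚ k) _ (Degree≤-mono (ℕ.n≤1+n k) (binomialInPowers-degree k))))

toPowers-degree : ∀ {D} L → Degree≤ D L → Degree≤ D (toPowers L)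
toPowers-degree L = concat⁺ ∘ map⁺ ∘ All.map (λ {t} k≤D →
  scale-degree (proj₁ t) _ (Degree≤-mono k≤D (binomialInPowers-degree (proj₂ t))))

dropConstant-degree : ∀ {D} L → Degree≤ D L → Degree≤ D (dropConstant L)
dropConstant-degree []                []        = []
dropConstant-degree ((c , zero)  ∷ L) (_ ∷ ps)  = dropConstant-degree L ps
dropConstant-degree ((c , suc j) ∷ L) (p ∷ ps)  = p ∷ dropConstant-degree L ps

dropConstant-positive : ∀ L → All (λ t → 1 ≤ proj₂ t) (dropConstant L)
dropConstant-positive []                = []
dropConstant-positive ((c , zero)  ∷ L) = dropConstant-positive L
dropConstant-positive ((c , suc j) ∷ L) = s≤s z≤n ∷ dropConstant-positive L

convolutionInPowers-degree : ∀ b b' → Degree≤ (b ℕ.+ b' ℕ.+ 1) (convolutionInPowers b b')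
convolutionInPowers-degree b b' = ++⁺
  (dropConstant-degree (toPowers Q) (toPowers-degree Q (Degree≤-mono (ℕ.≤-reflexive (ℕ.+-comm 1 (b ℕ.+ b')))
                                                                    (convolution<InBinomial-degree b b'))))
  (ℕ.≤-trans (ℕ.m≤n+m b' b) (ℕ.m≤m+n (b ℕ.+ b') 1) ∷ [])
  where Q = convolution<InBinomial b b'

convolutionInPowers-positive : ∀ b b' → All (λ t → 1 ≤ b' → 1 ≤ proj₂ t) (convolutionInPowers b b')
convolutionInPowers-positive b b' =
  ++⁺ (All.map (λ 1≤j _ → 1≤j) (dropConstant-positive (toPowers (convolution<InBinomial b b')))) ((λ 1≤b' → 1≤b') ∷ [])

-- Chains and their rearrangements

Chain : Set
Chain = List (ℕ × ℕ)

-- x is inserted into the decreasing chain y ∷ c after y, before y, or merged with y (equal n)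
insertions : ℕ × ℕ → Chain → List (ℚ × Chain)
insertions x []      = (1ℚ , x ∷ []) ∷ []
insertions x (y ∷ c) = map (map₂ (y ∷_)) (insertions x c)
                    ++ (1ℚ , x ∷ y ∷ c)
                     ∷ map (map₂ (λ j → (proj₁ x ℕ.+ proj₁ y , j) ∷ c)) (convolutionInPowers (proj₂ x) (proj₂ y))

orderings : Chain → List (ℚ × Chain)
orderings []      = (1ℚ , []) ∷ []
orderings (x ∷ c) = orderings c >>=ₗ insertions x

chainWeight : Chain → ℕ
chainWeight []      = 0
chainWeight (x ∷ c) = proj₁ x ℕ.+ proj₂ x ℕ.+ 1 ℕ.+ chainWeight c

infix 4 _≼_
record _≼_ (c' c : Chain) : Set where
  field
    nonempty : 1 ≤ length c → 1 ≤ length c'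
    weight-≤ : chainWeight c' ≤ chainWeight c
    t-pos    : All (λ x → 1 ≤ proj₂ x) c → All (λ x → 1 ≤ proj₂ x) c'
    u-pos    : All (λ x → 1 ≤ proj₁ x) c → All (λ x → 1 ≤ proj₁ x) c'
open _≼_

≼-refl : ∀ {c} → c ≼ c
≼-refl = record { nonempty = λ p → p ; weight-≤ = ℕ.≤-refl ; t-pos = λ p → p ; u-pos = λ p → p }

≼-trans : ∀ {c'' c' c} → c'' ≼ c' → c' ≼ c → c'' ≼ c
≼-trans p q = record
  { nonempty = nonempty p ∘ nonempty q
  ; weight-≤ = ℕ.≤-trans (weight-≤ p) (weight-≤ q)
  ; t-pos    = t-pos p ∘ t-pos q
  ; u-pos    = u-pos p ∘ u-pos q
  }

∷⁺-≼ : ∀ {c' c} x → c' ≼ c → x ∷ c' ≼ x ∷ c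
∷⁺-≼ x p = record
  { nonempty = λ _ → s≤s z≤n
  ; weight-≤ = ℕ.+-monoʳ-≤ (proj₁ x ℕ.+ proj₂ x ℕ.+ 1) (weight-≤ p)
  ; t-pos    = λ { (px ∷ ps) → px ∷ t-pos p ps }
  ; u-pos    = λ { (px ∷ ps) → px ∷ u-pos p ps }
  }

≼-swap : ∀ x y c → y ∷ x ∷ c ≼ x ∷ y ∷ c
≼-swap x y c = record
  { nonempty = λ _ → s≤s z≤n
  ; weight-≤ = ℕ.≤-reflexive (exchange (proj₁ y ℕ.+ proj₂ y ℕ.+ 1) (proj₁ x ℕ.+ proj₂ x ℕ.+ 1) (chainWeight c))
  ; t-pos    = λ { (px ∷ py ∷ ps) → py ∷ px ∷ ps }
  ; u-pos    = λ { (px ∷ py ∷ ps) → py ∷ px ∷ ps }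
  }
  where exchange : ∀ a b w → a ℕ.+ (b ℕ.+ w) ≡ b ℕ.+ (a ℕ.+ w)
        exchange = ℕ-Solver.solve-∀

merge-≼ : ∀ x y c j → j ≤ proj₂ x ℕ.+ proj₂ y ℕ.+ 1 → (1 ≤ proj₂ y → 1 ≤ j) → (proj₁ x ℕ.+ proj₁ y , j) ∷ c ≼ x ∷ y ∷ c
merge-≼ (a , b) (a' , b') c j j≤ j-pos = record
  { nonempty = λ _ → s≤s z≤n
  ; weight-≤ = ℕ.≤-trans (ℕ.+-monoˡ-≤ (chainWeight c) (ℕ.+-monoˡ-≤ 1 (ℕ.+-monoʳ-≤ (a ℕ.+ a') j≤)))
                         (ℕ.≤-reflexive (regroup a a' b b' (chainWeight c)))
  ; t-pos    = λ { (_ ∷ pb' ∷ ps) → j-pos pb' ∷ ps }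
  ; u-pos    = λ { (pa ∷ _ ∷ ps) → ℕ.≤-trans pa (ℕ.m≤m+n a a') ∷ ps }
  }
  where regroup : ∀ a a' b b' w → a ℕ.+ a' ℕ.+ (b ℕ.+ b' ℕ.+ 1) ℕ.+ 1 ℕ.+ w ≡ a ℕ.+ b ℕ.+ 1 ℕ.+ (a' ℕ.+ b' ℕ.+ 1 ℕ.+ w)
        regroup = ℕ-Solver.solve-∀

insertions-≼ : ∀ x c → All (λ qc → proj₂ qc ≼ x ∷ c) (insertions x c)
insertions-≼ x []      = ≼-refl ∷ []
insertions-≼ x (y ∷ c) = ++⁺
  (map⁺ (All.map (λ c'≼ → ≼-trans (∷⁺-≼ y c'≼) (≼-swap x y c)) (insertions-≼ x c)))
  (≼-refl ∷ map⁺ (All.zipWith (λ (j≤ , j-pos) → merge-≼ x y c _ j≤ j-pos)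
                              (convolutionInPowers-degree (proj₂ x) (proj₂ y) , convolutionInPowers-positive (proj₂ x) (proj₂ y))))

orderings-≼ : ∀ c → All (λ qc → proj₂ qc ≼ c) (orderings c)
orderings-≼ []      = ≼-refl ∷ []
orderings-≼ (x ∷ c) = All->>=ₗ (insertions x) (orderings-≼ c)
  (λ {c'} c'≼c → All.map (λ c''≼ → ≼-trans c''≼ (∷⁺-≼ x c'≼c)) (insertions-≼ x c'))

mono : ℕ × ℕ → ℕ → ℕ → ℚ
mono x n d = fromℕℚ (n ^ proj₁ x ℕ.* d ^ proj₂ x)

_≻_ : Maybe ℕ → ℕ → Bool
nothing ≻ n = true
just k  ≻ n = n <ᵇ k

≻-trans : ∀ m {n n'} → T (n' <ᵇ n) → T (m ≻ n) → T (m ≻ n')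
≻-trans nothing  _    _    = _
≻-trans (just k) n'<n n<k = ℕ.<⇒<ᵇ (ℕ.<-trans (ℕ.<ᵇ⇒< _ _ n'<n) (ℕ.<ᵇ⇒< _ k n<k))

inRange : ℕ → Maybe ℕ → ℕ → Bool
inRange ℓ m n = (ℓ ≤ᵇ n) ∧ (m ≻ n)

admissible : ℕ → Maybe ℕ → ℕ → ℕ → Bool
admissible ℓ m n d = inRange ℓ m n ∧ (0 <ᵇ d)

next : Bool → ℕ → Maybe ℕ
next true  n = just n
next false n = nothing

admissible-below : ∀ ℓ m n d n' d' →
  (n' <ᵇ n) ∧ (admissible ℓ m n d ∧ admissible ℓ m n' d') ≡ admissible ℓ m n d ∧ admissible ℓ (just n) n' d'
admissible-below ℓ m n d n' d' = T-ext to from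
  where
  to : T ((n' <ᵇ n) ∧ (admissible ℓ m n d ∧ admissible ℓ m n' d')) → T (admissible ℓ m n d ∧ admissible ℓ (just n) n' d')
  to t = let n'<n , adms = T-∧⁻ (n' <ᵇ n) t
             adm , adm' = T-∧⁻ (admissible ℓ m n d) adms
             range' , d'>0 = T-∧⁻ (inRange ℓ m n') adm'
         in T-∧⁺ adm (T-∧⁺ (T-∧⁺ (proj₁ (T-∧⁻ (ℓ ≤ᵇ n') range')) n'<n) d'>0)
  from : T (admissible ℓ m n d ∧ admissible ℓ (just n) n' d') → T ((n' <ᵇ n) ∧ (admissible ℓ m n d ∧ admissible ℓ m n' d'))
  from t = let adm , adm' = T-∧⁻ (admissible ℓ m n d) t
               range , _ = T-∧⁻ (inRange ℓ m n) adm
               range' , d'>0 = T-∧⁻ (inRange ℓ (just n) n') adm'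
               ℓ≤n' , n'<n = T-∧⁻ (ℓ ≤ᵇ n') range'
           in T-∧⁺ n'<n (T-∧⁺ adm (T-∧⁺ (T-∧⁺ ℓ≤n' (≻-trans m n'<n (proj₂ (T-∧⁻ (ℓ ≤ᵇ n) range)))) d'>0))

admissible-diagonal : ∀ ℓ m n d d' → admissible ℓ m n d ∧ admissible ℓ m n d' ≡ inRange ℓ m n ∧ ((0 <ᵇ d) ∧ (0 <ᵇ d'))
admissible-diagonal ℓ m n d d' with inRange ℓ m n
... | true  = refl
... | false = refl

mono-merge : ∀ x y n d d' Z → mono x n d * (mono y n d' * Z)
                            ≡ fromℕℚ (n ^ (proj₁ x ℕ.+ proj₁ y)) * (fromℕℚ (d ^ proj₂ x ℕ.* d' ^ proj₂ y) * Z)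
mono-merge x y n d d' Z = begin
  mono x n d * (mono y n d' * Z)                          ≡⟨ *-assoc (mono x n d) (mono y n d') Z ⟨
  (mono x n d * mono y n d') * Z                          ≡⟨ cong (_* Z) (fromℕℚ-* (n ^ proj₁ x ℕ.* d ^ proj₂ x) _) ⟨
  fromℕℚ (n ^ proj₁ x ℕ.* d ^ proj₂ x ℕ.* (n ^ proj₁ y ℕ.* d' ^ proj₂ y)) * Z
    ≡⟨ cong (λ k → fromℕℚ k * Z) (trans (regroup (n ^ proj₁ x) (d ^ proj₂ x) (n ^ proj₁ y) (d' ^ proj₂ y))
                                         (cong (ℕ._* (d ^ proj₂ x ℕ.* d' ^ proj₂ y)) (sym (ℕ.^-distribˡ-+-* n (proj₁ x) (proj₁ y))))) ⟩
  fromℕℚ (n ^ (proj₁ x ℕ.+ proj₁ y) ℕ.* (d ^ proj₂ x ℕ.* d' ^ proj₂ y)) * Z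
    ≡⟨ cong (_* Z) (fromℕℚ-* (n ^ (proj₁ x ℕ.+ proj₁ y)) _) ⟩
  (fromℕℚ (n ^ (proj₁ x ℕ.+ proj₁ y)) * fromℕℚ (d ^ proj₂ x ℕ.* d' ^ proj₂ y)) * Z
    ≡⟨ *-assoc (fromℕℚ (n ^ (proj₁ x ℕ.+ proj₁ y))) (fromℕℚ (d ^ proj₂ x ℕ.* d' ^ proj₂ y)) Z ⟩
  fromℕℚ (n ^ (proj₁ x ℕ.+ proj₁ y)) * (fromℕℚ (d ^ proj₂ x ℕ.* d' ^ proj₂ y) * Z) ∎
  where
  open ≡-Reasoning
  regroup : ∀ a b c e → a ℕ.* b ℕ.* (c ℕ.* e) ≡ a ℕ.* c ℕ.* (b ℕ.* e)
  regroup = ℕ-Solver.solve-∀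

module ChainSums (N : ℕ) where

  box : List ℕ
  box = upTo (suc N)

  ∑∑ : (ℕ → ℕ → ℚ) → ℚ
  ∑∑ f = ∑ box (λ n → ∑ box (f n))

  ∑∑-cong : ∀ {f g : ℕ → ℕ → ℚ} → (∀ n d → f n d ≡ g n d) → ∑∑ f ≡ ∑∑ g
  ∑∑-cong eq = ∑-cong box (λ n → ∑-cong box (eq n))

  ∑∑-zero : ∀ {f : ℕ → ℕ → ℚ} → (∀ n d → f n d ≡ 0ℚ) → ∑∑ f ≡ 0ℚ
  ∑∑-zero eq = ∑-zero box (λ n → ∑-zero box (eq n))

  ∑∑-+ : ∀ (f g : ℕ → ℕ → ℚ) → ∑∑ (λ n d → f n d + g n d) ≡ ∑∑ f + ∑∑ g
  ∑∑-+ f g = trans (∑-cong box (λ n → ∑-+ box (f n) (g n))) (∑-+ box (λ n → ∑ box (f n)) (λ n → ∑ box (g n)))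

  *-distribˡ-∑∑ : ∀ c (f : ℕ → ℕ → ℚ) → c * ∑∑ f ≡ ∑∑ (λ n d → c * f n d)
  *-distribˡ-∑∑ c f = trans (*-distribˡ-∑ c box _) (∑-cong box (λ n → *-distribˡ-∑ c box (f n)))

  []·-*-∑∑ : ∀ b W (f : ℕ → ℕ → ℚ) → [ b ]· (W * ∑∑ f) ≡ ∑∑ (λ n d → [ b ]· (W * f n d))
  []·-*-∑∑ b W f = trans (cong ([ b ]·_) (*-distribˡ-∑∑ W f)) (trans ([]·-∑ b box _) (∑-cong box (λ n → []·-∑ b box _)))

  ∑∑-∑ : ∀ {A : Set} (L : List A) (g : ℕ → ℕ → A → ℚ) → ∑∑ (λ n d → ∑ L (g n d)) ≡ ∑ L (λ a → ∑∑ (λ n d → g n d a))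
  ∑∑-∑ L g = trans (∑-cong box (λ n → ∑-comm box L (g n))) (∑-comm box L (λ n a → ∑ box (λ d → g n d a)))

  ∑∑-comm : ∀ (f : ℕ → ℕ → ℕ → ℕ → ℚ) → ∑∑ (λ n d → ∑∑ (f n d)) ≡ ∑∑ (λ n' d' → ∑∑ (λ n d → f n d n' d'))
  ∑∑-comm f = trans (∑∑-∑ box (λ n d n' → ∑ box (f n d n')))
                    (∑-cong box (λ n' → ∑∑-∑ box (λ n d d' → f n d n' d')))

  ∑∑-combine : ∀ {A : Set} (L : List (ℚ × A)) (F : A → ℕ → ℕ → ℚ) → ∑∑ (λ n d → combine L (λ a → F a n d)) ≡ combine L (λ a → ∑∑ (F a))
  ∑∑-combine L F = trans (∑∑-∑ L (λ n d t → proj₁ t * F (proj₂ t) n d)) (∑-cong L (λ t → sym (*-distribˡ-∑∑ (proj₁ t) (F (proj₂ t)))))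

  ∑∑-[]·-combine : ∀ {A : Set} (L : List (ℚ × A)) (g : ℕ → ℕ → Bool) (W : ℕ → ℕ → ℚ) (X : A → ℕ → ℕ → ℚ) →
    ∑∑ (λ n d → [ g n d ]· (W n d * combine L (λ a → X a n d))) ≡ combine L (λ a → ∑∑ (λ n d → [ g n d ]· (W n d * X a n d)))
  ∑∑-[]·-combine L g W X = trans (∑∑-cong (λ n d → []·-*-combine (g n d) (W n d) L (λ a → X a n d)))
                                 (∑∑-combine L (λ a n d → [ g n d ]· (W n d * X a n d)))

  ∑∑-trichotomy : ∀ (f : ℕ → ℕ → ℕ → ℕ → ℚ) →
    ∑∑ (λ n d → ∑∑ (f n d)) ≡ ∑∑ (λ n d → ∑∑ (λ n' d' → [ n' <ᵇ n ]· f n d n' d'))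
                            + ∑∑ (λ n d → ∑∑ (λ n' d' → [ n <ᵇ n' ]· f n d n' d'))
                            + ∑∑ (λ n d → ∑∑ (λ n' d' → [ n ≡ᵇ n' ]· f n d n' d'))
  ∑∑-trichotomy f = trans (∑∑-cong (λ n d → trans (∑∑-cong (λ n' d' → trichotomy-split n n' (f n d n' d')))
                                                  (split-inner n d)))
                          (trans (∑∑-+ (λ n d → ∑∑ (A n d) + ∑∑ (B n d)) (λ n d → ∑∑ (C n d)))
                                 (cong (_+ ∑∑ (λ n d → ∑∑ (C n d))) (∑∑-+ (λ n d → ∑∑ (A n d)) (λ n d → ∑∑ (B n d)))))
    where
    A B C : ℕ → ℕ → ℕ → ℕ → ℚ
    A n d n' d' = [ n' <ᵇ n ]· f n d n' d'
    B n d n' d' = [ n <ᵇ n' ]· f n d n' d'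
    C n d n' d' = [ n ≡ᵇ n' ]· f n d n' d'
    split-inner : ∀ n d → ∑∑ (λ n' d' → A n d n' d' + B n d n' d' + C n d n' d') ≡ ∑∑ (A n d) + ∑∑ (B n d) + ∑∑ (C n d)
    split-inner n d = trans (∑∑-+ (λ n' d' → A n d n' d' + B n d n' d') (C n d)) (cong (_+ ∑∑ (C n d)) (∑∑-+ (A n d) (B n d)))

  ∑∑-diagonal : ∀ (f : ℕ → ℕ → ℕ → ℕ → ℚ) →
    ∑∑ (λ n d → ∑∑ (λ n' d' → [ n ≡ᵇ n' ]· f n d n' d')) ≡ ∑ box (λ n → ∑∑ (λ d d' → f n d n d'))
  ∑∑-diagonal f = ∑-cong-∈ box (λ n n∈ → ∑-cong box (λ d → begin
    ∑ box (λ n' → ∑ box (λ d' → [ n ≡ᵇ n' ]· f n d n' d'))  ≡⟨ ∑-cong box (λ n' → []·-∑ (n ≡ᵇ n') box (f n d n')) ⟨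
    ∑ box (λ n' → [ n ≡ᵇ n' ]· ∑ box (f n d n'))            ≡⟨ ∑<-indicator (suc N) n (λ n' → ∑ box (f n d n')) (∈-upTo⁻ n∈) ⟩
    ∑ box (f n d n)                                         ∎))
    where open ≡-Reasoning

  Vanishing : (ℕ → ℚ) → Set
  Vanishing H = ∀ e → N < e → H e ≡ 0ℚ

  ∑-box-shift : ∀ d (H : ℕ → ℚ) → Vanishing H → ∑ box (λ x → H (d ℕ.+ x)) ≡ ∑ box (λ e → [ d ≤ᵇ e ]· H e)
  ∑-box-shift zero    H van = refl
  ∑-box-shift (suc d) H van = begin
    ∑ box (λ x → H (suc d ℕ.+ x))                         ≡⟨ ∑-box-shift d (H ∘ suc) (λ e N<e → van (suc e) (ℕ.m<n⇒m<1+n N<e)) ⟩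
    ∑ box (λ e → [ d ≤ᵇ e ]· H (suc e))                    ≡⟨ ∑<-suc N _ ⟩
    ∑< N (λ e → [ d ≤ᵇ e ]· H (suc e)) + [ d ≤ᵇ N ]· H (suc N)
      ≡⟨ cong (∑< N (λ e → [ d ≤ᵇ e ]· H (suc e)) +_) (trans (cong ([ d ≤ᵇ N ]·_) (van (suc N) ℕ.≤-refl)) ([]·-zero (d ≤ᵇ N))) ⟩
    ∑< N (λ e → [ d ≤ᵇ e ]· H (suc e)) + 0ℚ                ≡⟨ +-identityʳ _ ⟩
    ∑< N (λ e → [ d ≤ᵇ e ]· H (suc e))                     ≡⟨ ∑-cong (upTo N) (λ e → cong ([_]· H (suc e)) (≤ᵇ-suc d e)) ⟨
    ∑< N (λ e → [ suc d ≤ᵇ suc e ]· H (suc e))             ≡⟨ +-identityˡ _ ⟨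
    [ suc d ≤ᵇ 0 ]· H 0 + ∑< N (λ e → [ suc d ≤ᵇ suc e ]· H (suc e))
                                                          ≡⟨ ∑<-suc-shift N (λ e → [ suc d ≤ᵇ e ]· H e) ⟨
    ∑ box (λ e → [ suc d ≤ᵇ e ]· H e)                     ∎
    where
    open ≡-Reasoning
    ≤ᵇ-suc : ∀ d e → (suc d ≤ᵇ suc e) ≡ (d ≤ᵇ e)
    ≤ᵇ-suc d e = T-ext (λ t → ℕ.≤⇒≤ᵇ (ℕ.≤-pred (ℕ.≤ᵇ⇒≤ (suc d) (suc e) t))) (λ t → ℕ.≤⇒≤ᵇ (s≤s (ℕ.≤ᵇ⇒≤ d e t)))

  ∑-box-antidiagonal : ∀ (φ : ℕ → ℕ → ℚ) (H : ℕ → ℚ) → Vanishing H →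
    ∑ box (λ d → ∑ box (λ d' → φ d d' * H (d ℕ.+ d'))) ≡ ∑ box (λ e → ∑< (suc e) (λ d → φ d (e ∸ d)) * H e)
  ∑-box-antidiagonal φ H van = begin
    ∑ box (λ d → ∑ box (λ d' → φ d d' * H (d ℕ.+ d')))
      ≡⟨ ∑-cong box (λ d → ∑-cong box (λ d' → cong (λ z → φ d z * H (d ℕ.+ d')) (sym (ℕ.m+n∸m≡n d d')))) ⟩
    ∑ box (λ d → ∑ box (λ d' → φ d ((d ℕ.+ d') ∸ d) * H (d ℕ.+ d')))
      ≡⟨ ∑-cong box (λ d → ∑-box-shift d (λ e → φ d (e ∸ d) * H e)
                              (λ e N<e → trans (cong (φ d (e ∸ d) *_) (van e N<e)) (*-zeroʳ (φ d (e ∸ d))))) ⟩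
    ∑ box (λ d → ∑ box (λ e → [ d ≤ᵇ e ]· (φ d (e ∸ d) * H e)))
      ≡⟨ ∑-comm box box (λ d e → [ d ≤ᵇ e ]· (φ d (e ∸ d) * H e)) ⟩
    ∑ box (λ e → ∑ box (λ d → [ d ≤ᵇ e ]· (φ d (e ∸ d) * H e)))
      ≡⟨ ∑-cong-∈ box (λ e e∈ → begin
           ∑ box (λ d → [ d ≤ᵇ e ]· (φ d (e ∸ d) * H e))  ≡⟨ ∑-cong box (λ d → []·-*ʳ (d ≤ᵇ e) (H e) (φ d (e ∸ d))) ⟩
           ∑ box (λ d → [ d ≤ᵇ e ]· φ d (e ∸ d) * H e)    ≡⟨ *-distribʳ-∑ (H e) box (λ d → [ d ≤ᵇ e ]· φ d (e ∸ d)) ⟨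
           ∑ box (λ d → [ d ≤ᵇ e ]· φ d (e ∸ d)) * H e    ≡⟨ cong (_* H e) (∑<-truncate (suc N) e (λ d → φ d (e ∸ d)) (∈-upTo⁻ e∈)) ⟩
           ∑< (suc e) (λ d → φ d (e ∸ d)) * H e           ∎) ⟩
    ∑ box (λ e → ∑< (suc e) (λ d → φ d (e ∸ d)) * H e) ∎
    where open ≡-Reasoning

  Continuation : Set
  Continuation = ℕ → ℕ → ℚ

  VanishingCont : Continuation → Set
  VanishingCont K = ∀ D M → N < D → K D M ≡ 0ℚ

  -- Σ over links (nᵢ, dᵢ) ∈ [0, N]² with nᵢ ≥ ℓ, dᵢ ≥ 1, n₁ below m (and n₁ > n₂ > ⋯ if ordered)
  -- of ∏ nᵢ^{uᵢ} dᵢ^{tᵢ} · K (D + Σ dᵢ) (M + Σ nᵢ dᵢ)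
  chainSum : (ordered : Bool) → ℕ → Chain → Continuation → Maybe ℕ → ℕ → ℕ → ℚ
  chainSum o ℓ []      K m D M = K D M
  chainSum o ℓ (x ∷ c) K m D M =
    ∑∑ (λ n d → [ admissible ℓ m n d ]· (mono x n d * chainSum o ℓ c K (next o n) (D ℕ.+ d) (M ℕ.+ n ℕ.* d)))

  chainSum-vanishing : ∀ o ℓ c K → VanishingCont K → ∀ m D M → N < D → chainSum o ℓ c K m D M ≡ 0ℚ
  chainSum-vanishing o ℓ []      K van m D M N<D = van D M N<D
  chainSum-vanishing o ℓ (x ∷ c) K van m D M N<D = ∑∑-zero (λ n d → trans
    (cong (λ z → [ admissible ℓ m n d ]· (mono x n d * z))
          (chainSum-vanishing o ℓ c K van (next o n) (D ℕ.+ d) (M ℕ.+ n ℕ.* d) (ℕ.<-≤-trans N<D (ℕ.m≤m+n D d))))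
    (trans (cong ([ admissible ℓ m n d ]·_) (*-zeroʳ (mono x n d))) ([]·-zero (admissible ℓ m n d))))

  chainSum-zero : ∀ o ℓ c K → (∀ D M → K D M ≡ 0ℚ) → ∀ m D M → chainSum o ℓ c K m D M ≡ 0ℚ
  chainSum-zero o ℓ []      K K≡0 m D M = K≡0 D M
  chainSum-zero o ℓ (x ∷ c) K K≡0 m D M = ∑∑-zero (λ n d → trans
    (cong (λ z → [ admissible ℓ m n d ]· (mono x n d * z)) (chainSum-zero o ℓ c K K≡0 (next o n) (D ℕ.+ d) (M ℕ.+ n ℕ.* d)))
    (trans (cong ([ admissible ℓ m n d ]·_) (*-zeroʳ (mono x n d))) ([]·-zero (admissible ℓ m n d))))

  chainSum-cong : ∀ o ℓ c {K K' : Continuation} → (∀ D M → K D M ≡ K' D M) → ∀ m D M → chainSum o ℓ c K m D M ≡ chainSum o ℓ c K' m D M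
  chainSum-cong o ℓ []      eq m D M = eq D M
  chainSum-cong o ℓ (x ∷ c) eq m D M = ∑∑-cong (λ n d →
    cong (λ z → [ admissible ℓ m n d ]· (mono x n d * z)) (chainSum-cong o ℓ c eq (next o n) (D ℕ.+ d) (M ℕ.+ n ℕ.* d)))

  chainSum-combine : ∀ o ℓ c {A : Set} (L : List (ℚ × A)) (G : A → Continuation) m D M →
    chainSum o ℓ c (λ D' M' → combine L (λ a → G a D' M')) m D M ≡ combine L (λ a → chainSum o ℓ c (G a) m D M)
  chainSum-combine o ℓ []      L G m D M = refl
  chainSum-combine o ℓ (x ∷ c) L G m D M = trans
    (∑∑-cong (λ n d → cong (λ z → [ admissible ℓ m n d ]· (mono x n d * z))
                           (chainSum-combine o ℓ c L G (next o n) (D ℕ.+ d) (M ℕ.+ n ℕ.* d))))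
    (∑∑-[]·-combine L (admissible ℓ m) (mono x) (λ a n d → chainSum o ℓ c (G a) (next o n) (D ℕ.+ d) (M ℕ.+ n ℕ.* d)))

  insertSum : ℕ → ℕ × ℕ → Chain → Continuation → Maybe ℕ → ℕ → ℕ → ℚ
  insertSum ℓ x c K m D M =
    ∑∑ (λ n d → [ admissible ℓ m n d ]· (mono x n d * chainSum true ℓ c K m (D ℕ.+ d) (M ℕ.+ n ℕ.* d)))

  module InsertionStep (ℓ : ℕ) (x y : ℕ × ℕ) (c : Chain) (K : Continuation) (van : VanishingCont K) (m : Maybe ℕ) (D M : ℕ) where

    rest : ℕ → ℕ → ℕ → ℚ
    rest n' = chainSum true ℓ c K (just n')

    pairTerm : ℕ → ℕ → ℕ → ℕ → ℚ
    pairTerm n d n' d' = [ admissible ℓ m n d ∧ admissible ℓ m n' d' ]·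
                           (mono x n d * (mono y n' d' * rest n' (D ℕ.+ d ℕ.+ d') (M ℕ.+ n ℕ.* d ℕ.+ n' ℕ.* d')))

    expand : insertSum ℓ x (y ∷ c) K m D M ≡ ∑∑ (λ n d → ∑∑ (pairTerm n d))
    expand = ∑∑-cong (λ n d → trans ([]·-*-∑∑ (admissible ℓ m n d) (mono x n d) _)
                                     (∑∑-cong (λ n' d' → []·-nest (admissible ℓ m n d) (admissible ℓ m n' d') (mono x n d) _)))

    x-first : ∑∑ (λ n d → ∑∑ (λ n' d' → [ n' <ᵇ n ]· pairTerm n d n' d')) ≡ chainSum true ℓ (x ∷ y ∷ c) K m D M
    x-first = ∑∑-cong (λ n d → sym (trans ([]·-*-∑∑ (admissible ℓ m n d) (mono x n d) _) (∑∑-cong (pointwise n d))))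
      where
      pointwise : ∀ n d n' d' →
        [ admissible ℓ m n d ]· (mono x n d * [ admissible ℓ (just n) n' d' ]·
          (mono y n' d' * rest n' (D ℕ.+ d ℕ.+ d') (M ℕ.+ n ℕ.* d ℕ.+ n' ℕ.* d')))
          ≡ [ n' <ᵇ n ]· pairTerm n d n' d'
      pointwise n d n' d' = begin
        [ admissible ℓ m n d ]· (X * [ admissible ℓ (just n) n' d' ]· (Y * R))
          ≡⟨ []·-nest (admissible ℓ m n d) (admissible ℓ (just n) n' d') X (Y * R) ⟩
        [ admissible ℓ m n d ∧ admissible ℓ (just n) n' d' ]· (X * (Y * R))
          ≡⟨ cong ([_]· (X * (Y * R))) (admissible-below ℓ m n d n' d') ⟨
        [ (n' <ᵇ n) ∧ (admissible ℓ m n d ∧ admissible ℓ m n' d') ]· (X * (Y * R))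
          ≡⟨ []·-∧ (n' <ᵇ n) (admissible ℓ m n d ∧ admissible ℓ m n' d') (X * (Y * R)) ⟩
        [ n' <ᵇ n ]· pairTerm n d n' d' ∎
        where
        open ≡-Reasoning
        X = mono x n d
        Y = mono y n' d'
        R = rest n' (D ℕ.+ d ℕ.+ d') (M ℕ.+ n ℕ.* d ℕ.+ n' ℕ.* d')

    y-first : (∀ m' D' M' → insertSum ℓ x c K m' D' M' ≡ combine (insertions x c) (λ c' → chainSum true ℓ c' K m' D' M')) →
      ∑∑ (λ n d → ∑∑ (λ n' d' → [ n <ᵇ n' ]· pairTerm n d n' d')) ≡ combine (insertions x c) (λ c' → chainSum true ℓ (y ∷ c') K m D M)
    y-first insertion-c = begin
      ∑∑ (λ n d → ∑∑ (λ n' d' → [ n <ᵇ n' ]· pairTerm n d n' d'))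
        ≡⟨ ∑∑-comm (λ n d n' d' → [ n <ᵇ n' ]· pairTerm n d n' d') ⟩
      ∑∑ (λ n' d' → ∑∑ (λ n d → [ n <ᵇ n' ]· pairTerm n d n' d'))
        ≡⟨ ∑∑-cong (λ n' d' → trans (∑∑-cong (pointwise n' d')) (sym ([]·-*-∑∑ (admissible ℓ m n' d') (mono y n' d') _))) ⟩
      ∑∑ (λ n' d' → [ admissible ℓ m n' d' ]· (mono y n' d' * insertSum ℓ x c K (just n') (D ℕ.+ d') (M ℕ.+ n' ℕ.* d')))
        ≡⟨ ∑∑-cong (λ n' d' → cong (λ z → [ admissible ℓ m n' d' ]· (mono y n' d' * z))
                                    (insertion-c (just n') (D ℕ.+ d') (M ℕ.+ n' ℕ.* d'))) ⟩
      ∑∑ (λ n' d' → [ admissible ℓ m n' d' ]· (mono y n' d' * combine (insertions x c) (λ c' → after c' n' d')))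
        ≡⟨ ∑∑-[]·-combine (insertions x c) (admissible ℓ m) (mono y) after ⟩
      combine (insertions x c) (λ c' → chainSum true ℓ (y ∷ c') K m D M) ∎
      where
      open ≡-Reasoning
      after : Chain → ℕ → ℕ → ℚ
      after c' n' d' = chainSum true ℓ c' K (just n') (D ℕ.+ d') (M ℕ.+ n' ℕ.* d')
      pointwise : ∀ n' d' n d → [ n <ᵇ n' ]· pairTerm n d n' d'
        ≡ [ admissible ℓ m n' d' ]· (mono y n' d' * [ admissible ℓ (just n') n d ]·
            (mono x n d * rest n' (D ℕ.+ d' ℕ.+ d) (M ℕ.+ n' ℕ.* d' ℕ.+ n ℕ.* d)))
      pointwise n' d' n d = begin
        [ n <ᵇ n' ]· [ admissible ℓ m n d ∧ admissible ℓ m n' d' ]· (X * (Y * R))     ≡⟨ []·-∧ (n <ᵇ n') _ (X * (Y * R)) ⟨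
        [ (n <ᵇ n') ∧ (admissible ℓ m n d ∧ admissible ℓ m n' d') ]· (X * (Y * R))
          ≡⟨ cong (λ b → [ (n <ᵇ n') ∧ b ]· (X * (Y * R))) (∧-comm (admissible ℓ m n d) (admissible ℓ m n' d')) ⟩
        [ (n <ᵇ n') ∧ (admissible ℓ m n' d' ∧ admissible ℓ m n d) ]· (X * (Y * R))
          ≡⟨ cong₂ [_]·_ (admissible-below ℓ m n' d' n d) (trans (swap X Y R) (cong (λ z → Y * (X * z)) reorder)) ⟩
        [ admissible ℓ m n' d' ∧ admissible ℓ (just n') n d ]· (Y * (X * R'))
          ≡⟨ []·-nest (admissible ℓ m n' d') (admissible ℓ (just n') n d) Y (X * R') ⟨
        [ admissible ℓ m n' d' ]· (Y * [ admissible ℓ (just n') n d ]· (X * R'))      ∎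
        where
        X = mono x n d
        Y = mono y n' d'
        R = rest n' (D ℕ.+ d ℕ.+ d') (M ℕ.+ n ℕ.* d ℕ.+ n' ℕ.* d')
        R' = rest n' (D ℕ.+ d' ℕ.+ d) (M ℕ.+ n' ℕ.* d' ℕ.+ n ℕ.* d)
        reorder : R ≡ R'
        reorder = cong₂ (rest n') (exchange D d d') (exchange M (n ℕ.* d) (n' ℕ.* d'))
          where exchange : ∀ a b c → a ℕ.+ b ℕ.+ c ≡ a ℕ.+ c ℕ.+ b
                exchange = ℕ-Solver.solve-∀
        swap : ∀ X Y R → X * (Y * R) ≡ Y * (X * R)
        swap = solve-∀ ℚ-ring

    P : ℕ → ℚ
    P n = fromℕℚ (n ^ (proj₁ x ℕ.+ proj₁ y))

    φ : ℕ → ℕ → ℚ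
    φ d d' = [ (0 <ᵇ d) ∧ (0 <ᵇ d') ]· fromℕℚ (d ^ proj₂ x ℕ.* d' ^ proj₂ y)

    H : ℕ → ℕ → ℚ
    H n e = rest n (D ℕ.+ e) (M ℕ.+ n ℕ.* e)

    H-vanishing : ∀ n → Vanishing (H n)
    H-vanishing n e N<e = chainSum-vanishing true ℓ c K van (just n) (D ℕ.+ e) (M ℕ.+ n ℕ.* e) (ℕ.<-≤-trans N<e (ℕ.m≤n+m e D))

    diagonal-pairTerm : ∀ n d d' → pairTerm n d n d' ≡ [ inRange ℓ m n ]· (P n * (φ d d' * H n (d ℕ.+ d')))
    diagonal-pairTerm n d d' = begin
      pairTerm n d n d'
        ≡⟨ cong ([_]· (mono x n d * (mono y n d' * R))) (admissible-diagonal ℓ m n d d') ⟩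
      [ inRange ℓ m n ∧ q ]· (mono x n d * (mono y n d' * R))
        ≡⟨ []·-∧ (inRange ℓ m n) q _ ⟩
      [ inRange ℓ m n ]· [ q ]· (mono x n d * (mono y n d' * R))
        ≡⟨ cong (λ z → [ inRange ℓ m n ]· [ q ]· z) (mono-merge x y n d d' R) ⟩
      [ inRange ℓ m n ]· [ q ]· (P n * (V * R))
        ≡⟨ cong ([ inRange ℓ m n ]·_) (trans ([]·-*ˡ q (P n) (V * R)) (cong (P n *_) ([]·-*ʳ q R V))) ⟩
      [ inRange ℓ m n ]· (P n * (φ d d' * R))
        ≡⟨ cong (λ z → [ inRange ℓ m n ]· (P n * (φ d d' * z))) (cong₂ (rest n) (ℕ.+-assoc D d d') (distrib M n d d')) ⟩
      [ inRange ℓ m n ]· (P n * (φ d d' * H n (d ℕ.+ d'))) ∎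
      where
      open ≡-Reasoning
      q = (0 <ᵇ d) ∧ (0 <ᵇ d')
      V = fromℕℚ (d ^ proj₂ x ℕ.* d' ^ proj₂ y)
      R = rest n (D ℕ.+ d ℕ.+ d') (M ℕ.+ n ℕ.* d ℕ.+ n ℕ.* d')
      distrib : ∀ M n d d' → M ℕ.+ n ℕ.* d ℕ.+ n ℕ.* d' ≡ M ℕ.+ n ℕ.* (d ℕ.+ d')
      distrib = ℕ-Solver.solve-∀

    merged : ∑∑ (λ n d → ∑∑ (λ n' d' → [ n ≡ᵇ n' ]· pairTerm n d n' d'))
           ≡ combine (convolutionInPowers (proj₂ x) (proj₂ y)) (λ j → chainSum true ℓ ((proj₁ x ℕ.+ proj₁ y , j) ∷ c) K m D M)
    merged = begin
      ∑∑ (λ n d → ∑∑ (λ n' d' → [ n ≡ᵇ n' ]· pairTerm n d n' d'))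
        ≡⟨ ∑∑-diagonal pairTerm ⟩
      ∑ box (λ n → ∑∑ (λ d d' → pairTerm n d n d'))
        ≡⟨ ∑-cong box (λ n → trans (∑∑-cong (diagonal-pairTerm n)) (sym ([]·-*-∑∑ (inRange ℓ m n) (P n) _))) ⟩
      ∑ box (λ n → [ inRange ℓ m n ]· (P n * ∑ box (λ d → ∑ box (λ d' → φ d d' * H n (d ℕ.+ d')))))
        ≡⟨ ∑-cong box (λ n → cong (λ z → [ inRange ℓ m n ]· (P n * z)) (∑-box-antidiagonal φ (H n) (H-vanishing n))) ⟩
      ∑ box (λ n → [ inRange ℓ m n ]· (P n * ∑ box (λ e → convolution (proj₂ x) (proj₂ y) e * H n e)))
        ≡⟨ ∑-cong box (λ n → cong (λ z → [ inRange ℓ m n ]· (P n * z))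
                                  (∑-cong box (λ e → cong (_* H n e) (convolution-expansion (proj₂ x) (proj₂ y) e)))) ⟩
      ∑ box (λ n → [ inRange ℓ m n ]· (P n * ∑ box (λ e → [ 0 <ᵇ e ]· evalIn powerBasis PT e * H n e)))
        ≡⟨ ∑-cong box (λ n → trans ([]·-*-∑ (inRange ℓ m n) (P n) box _)
                                   (∑-cong box (λ e → []·-*-[]·-combine (inRange ℓ m n) (0 <ᵇ e) (P n) PT _ (H n e)))) ⟩
      ∑∑ (λ n e → combine PT (λ j → [ admissible ℓ m n e ]· ((P n * powerBasis j e) * H n e)))
        ≡⟨ ∑∑-combine PT (λ j n e → [ admissible ℓ m n e ]· ((P n * powerBasis j e) * H n e)) ⟩
      combine PT (λ j → ∑∑ (λ n e → [ admissible ℓ m n e ]· ((P n * powerBasis j e) * H n e)))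
        ≡⟨ combine-cong PT (λ j → ∑∑-cong (λ n e → cong (λ z → [ admissible ℓ m n e ]· (z * H n e))
                                                         (sym (fromℕℚ-* (n ^ (proj₁ x ℕ.+ proj₁ y)) (e ^ j))))) ⟩
      combine PT (λ j → chainSum true ℓ ((proj₁ x ℕ.+ proj₁ y , j) ∷ c) K m D M) ∎
      where
      open ≡-Reasoning
      PT = convolutionInPowers (proj₂ x) (proj₂ y)

  insertion : ∀ ℓ x c K → VanishingCont K → ∀ m D M →
    insertSum ℓ x c K m D M ≡ combine (insertions x c) (λ c' → chainSum true ℓ c' K m D M)
  insertion ℓ x []      K van m D M = sym (trans (+-identityʳ _) (*-identityˡ _))
  insertion ℓ x (y ∷ c) K van m D M = begin
    insertSum ℓ x (y ∷ c) K m D M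
      ≡⟨ expand ⟩
    ∑∑ (λ n d → ∑∑ (pairTerm n d))
      ≡⟨ ∑∑-trichotomy pairTerm ⟩
    ∑∑ (λ n d → ∑∑ (λ n' d' → [ n' <ᵇ n ]· pairTerm n d n' d'))
      + ∑∑ (λ n d → ∑∑ (λ n' d' → [ n <ᵇ n' ]· pairTerm n d n' d'))
      + ∑∑ (λ n d → ∑∑ (λ n' d' → [ n ≡ᵇ n' ]· pairTerm n d n' d'))
      ≡⟨ cong₂ _+_ (cong₂ _+_ x-first (y-first (insertion ℓ x c K van))) merged ⟩
    chainSum true ℓ (x ∷ y ∷ c) K m D M + combine (insertions x c) (f ∘ (y ∷_)) + combine PT (f ∘ merge)
      ≡⟨ regroup (chainSum true ℓ (x ∷ y ∷ c) K m D M) (combine (insertions x c) (f ∘ (y ∷_))) (combine PT (f ∘ merge)) ⟩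
    combine (insertions x c) (f ∘ (y ∷_)) + (1ℚ * chainSum true ℓ (x ∷ y ∷ c) K m D M + combine PT (f ∘ merge))
      ≡⟨ cong₂ (λ u v → u + (1ℚ * chainSum true ℓ (x ∷ y ∷ c) K m D M + v))
               (combine-map₂ (y ∷_) (insertions x c) f) (combine-map₂ merge PT f) ⟨
    combine (map (map₂ (y ∷_)) (insertions x c)) f + combine ((1ℚ , x ∷ y ∷ c) ∷ map (map₂ merge) PT) f
      ≡⟨ combine-++ (map (map₂ (y ∷_)) (insertions x c)) ((1ℚ , x ∷ y ∷ c) ∷ map (map₂ merge) PT) f ⟨
    combine (insertions x (y ∷ c)) f ∎
    where
    open ≡-Reasoning
    open InsertionStep ℓ x y c K van m D M
    PT = convolutionInPowers (proj₂ x) (proj₂ y)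
    f : Chain → ℚ
    f c' = chainSum true ℓ c' K m D M
    merge : ℕ → Chain
    merge j = (proj₁ x ℕ.+ proj₁ y , j) ∷ c
    regroup : ∀ a b c → a + b + c ≡ b + (1ℚ * a + c)
    regroup = solve-∀ ℚ-ring

  symmetrization : ∀ ℓ c K → VanishingCont K → ∀ D M →
    chainSum false ℓ c K nothing D M ≡ combine (orderings c) (λ c' → chainSum true ℓ c' K nothing D M)
  symmetrization ℓ []      K van D M = sym (trans (+-identityʳ _) (*-identityˡ _))
  symmetrization ℓ (x ∷ c) K van D M = begin
    chainSum false ℓ (x ∷ c) K nothing D M
      ≡⟨ ∑∑-cong (λ n d → cong (λ z → [ admissible ℓ nothing n d ]· (mono x n d * z))
                                (symmetrization ℓ c K van (D ℕ.+ d) (M ℕ.+ n ℕ.* d))) ⟩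
    ∑∑ (λ n d → [ admissible ℓ nothing n d ]· (mono x n d * combine (orderings c) (λ c' → after c' n d)))
      ≡⟨ ∑∑-[]·-combine (orderings c) (admissible ℓ nothing) (mono x) after ⟩
    combine (orderings c) (λ c' → insertSum ℓ x c' K nothing D M)
      ≡⟨ combine-cong (orderings c) (λ c' → insertion ℓ x c' K van nothing D M) ⟩
    combine (orderings c) (λ c' → combine (insertions x c') (λ c'' → chainSum true ℓ c'' K nothing D M))
      ≡⟨ combine->>= (orderings c) (insertions x) (λ c'' → chainSum true ℓ c'' K nothing D M) ⟨
    combine (orderings (x ∷ c)) (λ c' → chainSum true ℓ c' K nothing D M) ∎
    where
    open ≡-Reasoning
    after : Chain → ℕ → ℕ → ℚ
    after c' n d = chainSum true ℓ c' K nothing (D ℕ.+ d) (M ℕ.+ n ℕ.* d)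

  -- DL and DR are the sums of the d's of the two blocks, M the total Σ nᵢ dᵢ. The factor [DR ≤ N] holds on
  -- the support anyway; it makes the continuation vanish outside the box, as ∑-box-antidiagonal requires.
  balanced : ℕ → Continuation
  balanced DL DR M = [ DR ≤ᵇ N ]· [ (DL ≡ᵇ DR) ∧ (M ≡ᵇ N) ]· 1ℚ

  balanced-vanishing : ∀ DL → VanishingCont (balanced DL)
  balanced-vanishing DL DR M N<DR = []·-false _ (λ t → ℕ.<⇒≱ N<DR (ℕ.≤ᵇ⇒≤ DR N t))

  balanced-unbalanced : ∀ DL → N < DL → ∀ DR M → balanced DL DR M ≡ 0ℚ
  balanced-unbalanced DL N<DL DR M with DR ≤ᵇ N in eq
  ... | false = refl
  ... | true  = []·-false 1ℚ (λ t → ℕ.<⇒≱ N<DL (subst (_≤ N) (sym (ℕ.≡ᵇ⇒≡ DL DR (proj₁ (T-∧⁻ (DL ≡ᵇ DR) t))))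
                                                          (ℕ.≤ᵇ⇒≤ DR N (subst T (sym eq) _))))

  -- the left block has nᵢ ≥ 0, the right block nᵢ ≥ 1; `ordered` imposes strict decrease within each block
  blockSum : (ordered : Bool) → Chain → Chain → ℚ
  blockSum o cL cR = chainSum o 0 cL (λ DL M → chainSum o 1 cR (balanced DL) nothing 0 M) nothing 0 0

  blockSum-symmetrization : ∀ cL cR →
    blockSum false cL cR ≡ combine (orderings cL ⊗ₗ orderings cR) (λ p → blockSum true (proj₁ p) (proj₂ p))
  blockSum-symmetrization cL cR = begin
    blockSum false cL cR
      ≡⟨ chainSum-cong false 0 cL (λ DL M → symmetrization 1 cR (balanced DL) (balanced-vanishing DL) 0 M) nothing 0 0 ⟩
    chainSum false 0 cL right nothing 0 0
      ≡⟨ symmetrization 0 cL right right-vanishing 0 0 ⟩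
    combine (orderings cL) (λ cl → chainSum true 0 cl right nothing 0 0)
      ≡⟨ combine-cong (orderings cL) (λ cl → chainSum-combine true 0 cl (orderings cR)
                                                (λ cr DL M → chainSum true 1 cr (balanced DL) nothing 0 M) nothing 0 0) ⟩
    combine (orderings cL) (λ cl → combine (orderings cR) (λ cr → blockSum true cl cr))
      ≡⟨ combine-⊗ (orderings cL) (orderings cR) (λ p → blockSum true (proj₁ p) (proj₂ p)) ⟨
    combine (orderings cL ⊗ₗ orderings cR) (λ p → blockSum true (proj₁ p) (proj₂ p)) ∎
    where
    open ≡-Reasoning
    right : Continuation
    right DL M = combine (orderings cR) (λ cr → chainSum true 1 cr (balanced DL) nothing 0 M)
    right-vanishing : VanishingCont right
    right-vanishing DL M N<DL = combine-zero (orderings cR) (λ cr →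
      chainSum-zero true 1 cr (balanced DL) (balanced-unbalanced DL N<DL) nothing 0 M)

-- Coefficients as block sums

fromℕℚ-sum : ∀ xs → fromℕℚ (sumL xs) ≡ ∑ xs fromℕℚ
fromℕℚ-sum []       = refl
fromℕℚ-sum (x ∷ xs) = trans (fromℕℚ-+ x (sumL xs)) (cong (fromℕℚ x +_) (fromℕℚ-sum xs))

fromℕℚ-if : ∀ b x → fromℕℚ (if b then x else 0) ≡ [ b ]· fromℕℚ x
fromℕℚ-if true  x = refl
fromℕℚ-if false x = refl

fromℕℚ-boxSum : ∀ k N c w →
  fromℕℚ (boxSum k N c w) ≡ ∑ (tuples k N) (λ ns → ∑ (tuples k N) (λ ds → [ c ns ds ]· fromℕℚ (w ns ds)))
fromℕℚ-boxSum k N c w = begin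
  fromℕℚ (boxSum k N c w)                                     ≡⟨ fromℕℚ-sum (concatMap row (tuples k N)) ⟩
  ∑ (concatMap row (tuples k N)) fromℕℚ                       ≡⟨ ∑-concatMap row (tuples k N) fromℕℚ ⟩
  ∑ (tuples k N) (λ ns → ∑ (row ns) fromℕℚ)                   ≡⟨ ∑-cong (tuples k N) (λ ns →
                                                                   trans (∑-map _ (tuples k N) fromℕℚ)
                                                                         (∑-cong (tuples k N) (λ ds → fromℕℚ-if (c ns ds) (w ns ds)))) ⟩
  ∑ (tuples k N) (λ ns → ∑ (tuples k N) (λ ds → [ c ns ds ]· fromℕℚ (w ns ds))) ∎
  where
  open ≡-Reasoning
  row : Vec ℕ k → List ℕ
  row ns = map (λ ds → if c ns ds then w ns ds else 0) (tuples k N)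

pairs : ∀ {k} → Vec ℕ k → Vec ℕ k → Chain
pairs u t = V.toList (V.zip u t)

admissibleVec : Bool → ℕ → Maybe ℕ → ∀ {k} → Vec ℕ k → Vec ℕ k → Bool
admissibleVec o ℓ m []       []       = true
admissibleVec o ℓ m (n ∷ ns) (d ∷ ds) = admissible ℓ m n d ∧ admissibleVec o ℓ (next o n) ns ds

dot : ∀ {k} → Vec ℕ k → Vec ℕ k → ℕ
dot ns ds = V.sum (zipWith ℕ._*_ ns ds)

take-drop-++ : ∀ {r s} (xs : Vec ℕ r) (ys : Vec ℕ s) → take r (xs ++ᵥ ys) ≡ xs × drop r (xs ++ᵥ ys) ≡ ys
take-drop-++ {r} xs ys = ++-injective (take r (xs ++ᵥ ys)) xs (take++drop≡id r (xs ++ᵥ ys))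

allPos-++ : ∀ {r s} (xs : Vec ℕ r) (ys : Vec ℕ s) → allPos (xs ++ᵥ ys) ≡ allPos xs ∧ allPos ys
allPos-++ []       ys = refl
allPos-++ (x ∷ xs) ys = trans (cong ((0 <ᵇ x) ∧_) (allPos-++ xs ys)) (sym (∧-assoc (0 <ᵇ x) (allPos xs) (allPos ys)))

dot-++ : ∀ {r s} (ns₁ ds₁ : Vec ℕ r) (ns₂ ds₂ : Vec ℕ s) → dot (ns₁ ++ᵥ ns₂) (ds₁ ++ᵥ ds₂) ≡ dot ns₁ ds₁ ℕ.+ dot ns₂ ds₂
dot-++ []        []        ns₂ ds₂ = refl
dot-++ (n ∷ ns₁) (d ∷ ds₁) ns₂ ds₂ = trans (cong (n ℕ.* d ℕ.+_) (dot-++ ns₁ ds₁ ns₂ ds₂)) (sym (ℕ.+-assoc (n ℕ.* d) _ _))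

monomial-++ : ∀ {r s} (ns₁ ds₁ u₁ t₁ : Vec ℕ r) (ns₂ ds₂ u₂ t₂ : Vec ℕ s) →
  monomial (ns₁ ++ᵥ ns₂) (ds₁ ++ᵥ ds₂) (u₁ ++ᵥ u₂) (t₁ ++ᵥ t₂) ≡ monomial ns₁ ds₁ u₁ t₁ ℕ.* monomial ns₂ ds₂ u₂ t₂
monomial-++ []        []        []       []       ns₂ ds₂ u₂ t₂ = sym (ℕ.+-identityʳ _)
monomial-++ (n ∷ ns₁) (d ∷ ds₁) (a ∷ u₁) (b ∷ t₁) ns₂ ds₂ u₂ t₂ =
  trans (cong (n ^ a ℕ.* d ^ b ℕ.*_) (monomial-++ ns₁ ds₁ u₁ t₁ ns₂ ds₂ u₂ t₂)) (sym (ℕ.*-assoc (n ^ a ℕ.* d ^ b) _ _))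

sum≤dot : ∀ {k} (ns ds : Vec ℕ k) → T (allPos ns) → V.sum ds ≤ dot ns ds
sum≤dot []           []       _ = z≤n
sum≤dot (suc n ∷ ns) (d ∷ ds) t = ℕ.+-mono-≤ (ℕ.m≤m+n d (n ℕ.* d)) (sum≤dot ns ds t)

atLeast : ℕ → ∀ {k} → Vec ℕ k → Bool
atLeast ℓ []       = true
atLeast ℓ (n ∷ ns) = (ℓ ≤ᵇ n) ∧ atLeast ℓ ns

atLeast-0 : ∀ {k} (ns : Vec ℕ k) → atLeast 0 ns ≡ true
atLeast-0 []       = refl
atLeast-0 (n ∷ ns) = atLeast-0 ns

atLeast-1 : ∀ {k} (ns : Vec ℕ k) → atLeast 1 ns ≡ allPos ns
atLeast-1 []       = refl
atLeast-1 (n ∷ ns) = cong ((0 <ᵇ n) ∧_) (atLeast-1 ns)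

inOrder : Bool → Maybe ℕ → ∀ {k} → Vec ℕ k → Bool
inOrder o m []       = true
inOrder o m (n ∷ ns) = (m ≻ n) ∧ inOrder o (next o n) ns

inOrder-false : ∀ {k} (ns : Vec ℕ k) → inOrder false nothing ns ≡ true
inOrder-false []       = refl
inOrder-false (n ∷ ns) = inOrder-false ns

inOrder-true : ∀ {k} (ns : Vec ℕ k) → inOrder true nothing ns ≡ strictDec ns
inOrder-true []       = refl
inOrder-true (n ∷ ns) = below n ns
  where
  below : ∀ n {k} (ns : Vec ℕ k) → inOrder true (just n) ns ≡ strictDec (n ∷ ns)
  below n []       = refl
  below n (n' ∷ ns) = cong ((n' <ᵇ n) ∧_) (below n' ns)

admissibleVec-spec : ∀ o ℓ m {k} (ns ds : Vec ℕ k) → admissibleVec o ℓ m ns ds ≡ allPos ds ∧ (atLeast ℓ ns ∧ inOrder o m ns)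
admissibleVec-spec o ℓ m []       []       = refl
admissibleVec-spec o ℓ m (n ∷ ns) (d ∷ ds) =
  trans (cong (admissible ℓ m n d ∧_) (admissibleVec-spec o ℓ (next o n) ns ds)) (regroup (ℓ ≤ᵇ n) (m ≻ n) (0 <ᵇ d) _ _ _)
  where
  regroup : ∀ a b c P Q R → ((a ∧ b) ∧ c) ∧ (P ∧ (Q ∧ R)) ≡ (c ∧ P) ∧ ((a ∧ Q) ∧ (b ∧ R))
  regroup true  true  true  P Q R = refl
  regroup a     b     false P Q R = cong (_∧ (P ∧ (Q ∧ R))) (∧-zeroʳ (a ∧ b))
  regroup false b     true  P Q R = sym (∧-zeroʳ P)
  regroup true  false true  P Q R = sym (trans (cong (P ∧_) (∧-zeroʳ Q)) (∧-zeroʳ P))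

condS-++ : ∀ r s N (ns₁ ds₁ : Vec ℕ r) (ns₂ ds₂ : Vec ℕ s) →
  condS r s N (ns₁ ++ᵥ ns₂) (ds₁ ++ᵥ ds₂)
    ≡ (allPos ds₁ ∧ allPos ds₂) ∧ (allPos ns₂ ∧ ((V.sum ds₁ ≡ᵇ V.sum ds₂) ∧ (dot ns₁ ds₁ ℕ.+ dot ns₂ ds₂ ≡ᵇ N)))
condS-++ r s N ns₁ ds₁ ns₂ ds₂ = cong₂ _∧_ (allPos-++ ds₁ ds₂)
  (cong₂ _∧_ (cong allPos (proj₂ (take-drop-++ ns₁ ns₂)))
             (cong₂ _∧_ (cong₂ (λ a b → V.sum a ≡ᵇ V.sum b) (proj₁ (take-drop-++ ds₁ ds₂)) (proj₂ (take-drop-++ ds₁ ds₂)))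
                        (cong (_≡ᵇ N) (dot-++ ns₁ ds₁ ns₂ ds₂))))

∧-rearrange : ∀ p₁ p₂ q e₁ e₂ o₁ o₂ c → (T q → T e₂ → T c) →
  ((p₁ ∧ p₂) ∧ (q ∧ (e₁ ∧ e₂))) ∧ (o₁ ∧ o₂) ≡ ((p₁ ∧ o₁) ∧ (p₂ ∧ (q ∧ o₂))) ∧ (c ∧ (e₁ ∧ e₂))
∧-rearrange p₁ p₂ q e₁ e₂ o₁ o₂ c q⇒e₂⇒c = T-ext to from
  where
  to : T (((p₁ ∧ p₂) ∧ (q ∧ (e₁ ∧ e₂))) ∧ (o₁ ∧ o₂)) → T (((p₁ ∧ o₁) ∧ (p₂ ∧ (q ∧ o₂))) ∧ (c ∧ (e₁ ∧ e₂)))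
  to t = let pqe , os = T-∧⁻ ((p₁ ∧ p₂) ∧ (q ∧ (e₁ ∧ e₂))) t
             ps , qe = T-∧⁻ (p₁ ∧ p₂) pqe
             tp₁ , tp₂ = T-∧⁻ p₁ ps
             tq , te = T-∧⁻ q qe
             to₁ , to₂ = T-∧⁻ o₁ os
         in T-∧⁺ (T-∧⁺ (T-∧⁺ tp₁ to₁) (T-∧⁺ tp₂ (T-∧⁺ tq to₂))) (T-∧⁺ (q⇒e₂⇒c tq (proj₂ (T-∧⁻ e₁ te))) te)
  from : T (((p₁ ∧ o₁) ∧ (p₂ ∧ (q ∧ o₂))) ∧ (c ∧ (e₁ ∧ e₂))) → T (((p₁ ∧ p₂) ∧ (q ∧ (e₁ ∧ e₂))) ∧ (o₁ ∧ o₂))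
  from t = let l , ce = T-∧⁻ ((p₁ ∧ o₁) ∧ (p₂ ∧ (q ∧ o₂))) t
               po₁ , r = T-∧⁻ (p₁ ∧ o₁) l
               tp₁ , to₁ = T-∧⁻ p₁ po₁
               tp₂ , qo₂ = T-∧⁻ p₂ r
               tq , to₂ = T-∧⁻ q qo₂
           in T-∧⁺ (T-∧⁺ (T-∧⁺ tp₁ tp₂) (T-∧⁺ tq (proj₂ (T-∧⁻ c ce)))) (T-∧⁺ to₁ to₂)

condition : Bool → (r s N : ℕ) → Vec ℕ (r ℕ.+ s) → Vec ℕ (r ℕ.+ s) → Bool
condition false = condS
condition true  = condT

condition-++ : ∀ o r s N (ns₁ ds₁ : Vec ℕ r) (ns₂ ds₂ : Vec ℕ s) →
  condition o r s N (ns₁ ++ᵥ ns₂) (ds₁ ++ᵥ ds₂)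
    ≡ ((allPos ds₁ ∧ allPos ds₂) ∧ (allPos ns₂ ∧ ((V.sum ds₁ ≡ᵇ V.sum ds₂) ∧ (dot ns₁ ds₁ ℕ.+ dot ns₂ ds₂ ≡ᵇ N))))
      ∧ (inOrder o nothing ns₁ ∧ inOrder o nothing ns₂)
condition-++ false r s N ns₁ ds₁ ns₂ ds₂ =
  trans (condS-++ r s N ns₁ ds₁ ns₂ ds₂)
        (sym (trans (cong₂ (λ a b → core ∧ (a ∧ b)) (inOrder-false ns₁) (inOrder-false ns₂)) (∧-identityʳ core)))
  where core = (allPos ds₁ ∧ allPos ds₂) ∧ (allPos ns₂ ∧ ((V.sum ds₁ ≡ᵇ V.sum ds₂) ∧ (dot ns₁ ds₁ ℕ.+ dot ns₂ ds₂ ≡ᵇ N)))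
condition-++ true  r s N ns₁ ds₁ ns₂ ds₂ = cong₂ _∧_ (condS-++ r s N ns₁ ds₁ ns₂ ds₂)
  (cong₂ _∧_ (trans (cong strictDec (proj₁ (take-drop-++ ns₁ ns₂))) (sym (inOrder-true ns₁)))
             (trans (cong strictDec (proj₂ (take-drop-++ ns₁ ns₂))) (sym (inOrder-true ns₂))))

module Coefficients (N : ℕ) where
  open ChainSums N

  ∑∑ⁿ : ∀ k → (Vec ℕ k → Vec ℕ k → ℚ) → ℚ
  ∑∑ⁿ zero    G = G [] []
  ∑∑ⁿ (suc k) G = ∑∑ (λ n d → ∑∑ⁿ k (λ ns ds → G (n ∷ ns) (d ∷ ds)))

  ∑∑ⁿ-cong : ∀ k {G G' : Vec ℕ k → Vec ℕ k → ℚ} → (∀ ns ds → G ns ds ≡ G' ns ds) → ∑∑ⁿ k G ≡ ∑∑ⁿ k G'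
  ∑∑ⁿ-cong zero    eq = eq [] []
  ∑∑ⁿ-cong (suc k) eq = ∑∑-cong (λ n d → ∑∑ⁿ-cong k (λ ns ds → eq (n ∷ ns) (d ∷ ds)))

  []·-*-∑∑ⁿ : ∀ k b W (G : Vec ℕ k → Vec ℕ k → ℚ) → [ b ]· (W * ∑∑ⁿ k G) ≡ ∑∑ⁿ k (λ ns ds → [ b ]· (W * G ns ds))
  []·-*-∑∑ⁿ zero    b W G = refl
  []·-*-∑∑ⁿ (suc k) b W G = trans ([]·-*-∑∑ b W (λ n d → ∑∑ⁿ k (λ ns ds → G (n ∷ ns) (d ∷ ds))))
                                  (∑∑-cong (λ n d → []·-*-∑∑ⁿ k b W (λ ns ds → G (n ∷ ns) (d ∷ ds))))

  ∑∑ⁿ-++ : ∀ r s (G : Vec ℕ (r ℕ.+ s) → Vec ℕ (r ℕ.+ s) → ℚ) →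
    ∑∑ⁿ (r ℕ.+ s) G ≡ ∑∑ⁿ r (λ ns₁ ds₁ → ∑∑ⁿ s (λ ns₂ ds₂ → G (ns₁ ++ᵥ ns₂) (ds₁ ++ᵥ ds₂)))
  ∑∑ⁿ-++ zero    s G = refl
  ∑∑ⁿ-++ (suc r) s G = ∑∑-cong (λ n d → ∑∑ⁿ-++ r s _)

  ∑-tuples-suc : ∀ k (f : Vec ℕ (suc k) → ℚ) → ∑ (tuples (suc k) N) f ≡ ∑ box (λ n → ∑ (tuples k N) (f ∘ (n ∷_)))
  ∑-tuples-suc k f = trans (∑-concatMap (λ n → map (n ∷_) (tuples k N)) box f) (∑-cong box (λ n → ∑-map (n ∷_) (tuples k N) f))

  ∑-tuples² : ∀ k (G : Vec ℕ k → Vec ℕ k → ℚ) → ∑ (tuples k N) (λ ns → ∑ (tuples k N) (G ns)) ≡ ∑∑ⁿ k G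
  ∑-tuples² zero    G = trans (+-identityʳ _) (+-identityʳ _)
  ∑-tuples² (suc k) G = begin
    ∑ (tuples (suc k) N) (λ ns → ∑ (tuples (suc k) N) (G ns))
      ≡⟨ ∑-tuples-suc k _ ⟩
    ∑ box (λ n → ∑ (tuples k N) (λ ns → ∑ (tuples (suc k) N) (G (n ∷ ns))))
      ≡⟨ ∑-cong box (λ n → ∑-cong (tuples k N) (λ ns → ∑-tuples-suc k (G (n ∷ ns)))) ⟩
    ∑ box (λ n → ∑ (tuples k N) (λ ns → ∑ box (λ d → ∑ (tuples k N) (λ ds → G (n ∷ ns) (d ∷ ds)))))
      ≡⟨ ∑-cong box (λ n → ∑-comm (tuples k N) box _) ⟩
    ∑∑ (λ n d → ∑ (tuples k N) (λ ns → ∑ (tuples k N) (λ ds → G (n ∷ ns) (d ∷ ds))))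
      ≡⟨ ∑∑-cong (λ n d → ∑-tuples² k _) ⟩
    ∑∑ⁿ (suc k) G ∎
    where open ≡-Reasoning

  chainSum-expansion : ∀ o ℓ {k} (u t : Vec ℕ k) K m D M →
    chainSum o ℓ (pairs u t) K m D M
      ≡ ∑∑ⁿ k (λ ns ds → [ admissibleVec o ℓ m ns ds ]· (fromℕℚ (monomial ns ds u t) * K (D ℕ.+ V.sum ds) (M ℕ.+ dot ns ds)))
  chainSum-expansion o ℓ []      []      K m D M = sym (trans (*-identityˡ _) (cong₂ K (ℕ.+-identityʳ D) (ℕ.+-identityʳ M)))
  chainSum-expansion o ℓ (a ∷ u) (b ∷ t) K m D M = begin
    chainSum o ℓ (pairs (a ∷ u) (b ∷ t)) K m D M
      ≡⟨ ∑∑-cong (λ n d → cong (λ z → [ admissible ℓ m n d ]· (mono (a , b) n d * z))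
                                (chainSum-expansion o ℓ u t K (next o n) (D ℕ.+ d) (M ℕ.+ n ℕ.* d))) ⟩
    ∑∑ (λ n d → [ admissible ℓ m n d ]· (mono (a , b) n d * ∑∑ⁿ _ (summand n d)))
      ≡⟨ ∑∑-cong (λ n d → trans ([]·-*-∑∑ⁿ _ (admissible ℓ m n d) (mono (a , b) n d) (summand n d))
                                 (∑∑ⁿ-cong _ (pointwise n d))) ⟩
    ∑∑ⁿ (suc _) (λ ns ds → [ admissibleVec o ℓ m ns ds ]·
                              (fromℕℚ (monomial ns ds (a ∷ u) (b ∷ t)) * K (D ℕ.+ V.sum ds) (M ℕ.+ dot ns ds))) ∎
    where
    open ≡-Reasoning
    summand : ℕ → ℕ → Vec ℕ _ → Vec ℕ _ → ℚ
    summand n d ns ds = [ admissibleVec o ℓ (next o n) ns ds ]·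
                          (fromℕℚ (monomial ns ds u t) * K (D ℕ.+ d ℕ.+ V.sum ds) (M ℕ.+ n ℕ.* d ℕ.+ dot ns ds))
    pointwise : ∀ n d ns ds → [ admissible ℓ m n d ]· (mono (a , b) n d * summand n d ns ds)
      ≡ [ admissibleVec o ℓ m (n ∷ ns) (d ∷ ds) ]·
          (fromℕℚ (monomial (n ∷ ns) (d ∷ ds) (a ∷ u) (b ∷ t)) * K (D ℕ.+ (d ℕ.+ V.sum ds)) (M ℕ.+ (n ℕ.* d ℕ.+ dot ns ds)))
    pointwise n d ns ds = begin
      [ admissible ℓ m n d ]· (X * [ admissibleVec o ℓ (next o n) ns ds ]· (Y * Z))
        ≡⟨ []·-nest (admissible ℓ m n d) (admissibleVec o ℓ (next o n) ns ds) X (Y * Z) ⟩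
      [ admissibleVec o ℓ m (n ∷ ns) (d ∷ ds) ]· (X * (Y * Z))
        ≡⟨ cong ([ admissibleVec o ℓ m (n ∷ ns) (d ∷ ds) ]·_) (*-assoc X Y Z) ⟨
      [ admissibleVec o ℓ m (n ∷ ns) (d ∷ ds) ]· ((X * Y) * Z)
        ≡⟨ cong ([ admissibleVec o ℓ m (n ∷ ns) (d ∷ ds) ]·_)
                (cong₂ _*_ (sym (fromℕℚ-* (n ^ a ℕ.* d ^ b) (monomial ns ds u t)))
                           (cong₂ K (ℕ.+-assoc D d (V.sum ds)) (ℕ.+-assoc M (n ℕ.* d) (dot ns ds)))) ⟩
      [ admissibleVec o ℓ m (n ∷ ns) (d ∷ ds) ]·
        (fromℕℚ (monomial (n ∷ ns) (d ∷ ds) (a ∷ u) (b ∷ t)) * K (D ℕ.+ (d ℕ.+ V.sum ds)) (M ℕ.+ (n ℕ.* d ℕ.+ dot ns ds))) ∎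
      where
      X = mono (a , b) n d
      Y = fromℕℚ (monomial ns ds u t)
      Z = K (D ℕ.+ d ℕ.+ V.sum ds) (M ℕ.+ n ℕ.* d ℕ.+ dot ns ds)

  block-summand : ∀ o {r s} (u₁ t₁ ns₁ ds₁ : Vec ℕ r) (u₂ t₂ ns₂ ds₂ : Vec ℕ s) →
    [ condition o r s N (ns₁ ++ᵥ ns₂) (ds₁ ++ᵥ ds₂) ]· fromℕℚ (monomial (ns₁ ++ᵥ ns₂) (ds₁ ++ᵥ ds₂) (u₁ ++ᵥ u₂) (t₁ ++ᵥ t₂))
      ≡ [ admissibleVec o 0 nothing ns₁ ds₁ ]· (fromℕℚ (monomial ns₁ ds₁ u₁ t₁) *
          [ admissibleVec o 1 nothing ns₂ ds₂ ]·
            (fromℕℚ (monomial ns₂ ds₂ u₂ t₂) * balanced (V.sum ds₁) (V.sum ds₂) (dot ns₁ ds₁ ℕ.+ dot ns₂ ds₂)))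
  block-summand o {r} {s} u₁ t₁ ns₁ ds₁ u₂ t₂ ns₂ ds₂ = begin
    [ condition o r s N (ns₁ ++ᵥ ns₂) (ds₁ ++ᵥ ds₂) ]· fromℕℚ (monomial (ns₁ ++ᵥ ns₂) (ds₁ ++ᵥ ds₂) (u₁ ++ᵥ u₂) (t₁ ++ᵥ t₂))
      ≡⟨ cong₂ [_]·_ (trans (condition-++ o r s N ns₁ ds₁ ns₂ ds₂) guards)
                     (trans (cong fromℕℚ (monomial-++ ns₁ ds₁ u₁ t₁ ns₂ ds₂ u₂ t₂))
                            (fromℕℚ-* (monomial ns₁ ds₁ u₁ t₁) (monomial ns₂ ds₂ u₂ t₂))) ⟩
    [ (A₁ ∧ A₂) ∧ ((V.sum ds₂ ≤ᵇ N) ∧ ((V.sum ds₁ ≡ᵇ V.sum ds₂) ∧ (M ≡ᵇ N))) ]· (P₁ * P₂)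
      ≡⟨ []·-nest² A₁ A₂ (V.sum ds₂ ≤ᵇ N) ((V.sum ds₁ ≡ᵇ V.sum ds₂) ∧ (M ≡ᵇ N)) P₁ P₂ ⟨
    [ A₁ ]· (P₁ * [ A₂ ]· (P₂ * balanced (V.sum ds₁) (V.sum ds₂) M)) ∎
    where
    open ≡-Reasoning
    A₁ = admissibleVec o 0 nothing ns₁ ds₁
    A₂ = admissibleVec o 1 nothing ns₂ ds₂
    P₁ = fromℕℚ (monomial ns₁ ds₁ u₁ t₁)
    P₂ = fromℕℚ (monomial ns₂ ds₂ u₂ t₂)
    M = dot ns₁ ds₁ ℕ.+ dot ns₂ ds₂
    bounded : T (allPos ns₂) → T (M ≡ᵇ N) → T (V.sum ds₂ ≤ᵇ N)
    bounded pos M≡N = ℕ.≤⇒≤ᵇ (ℕ.≤-trans (sum≤dot ns₂ ds₂ pos)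
                                        (ℕ.≤-trans (ℕ.m≤n+m (dot ns₂ ds₂) (dot ns₁ ds₁)) (ℕ.≤-reflexive (ℕ.≡ᵇ⇒≡ M N M≡N))))
    guards : ((allPos ds₁ ∧ allPos ds₂) ∧ (allPos ns₂ ∧ ((V.sum ds₁ ≡ᵇ V.sum ds₂) ∧ (M ≡ᵇ N))))
               ∧ (inOrder o nothing ns₁ ∧ inOrder o nothing ns₂)
           ≡ (A₁ ∧ A₂) ∧ ((V.sum ds₂ ≤ᵇ N) ∧ ((V.sum ds₁ ≡ᵇ V.sum ds₂) ∧ (M ≡ᵇ N)))
    guards = trans (∧-rearrange (allPos ds₁) (allPos ds₂) (allPos ns₂) (V.sum ds₁ ≡ᵇ V.sum ds₂) (M ≡ᵇ N)
                                 (inOrder o nothing ns₁) (inOrder o nothing ns₂) (V.sum ds₂ ≤ᵇ N) bounded)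
      (cong (_∧ ((V.sum ds₂ ≤ᵇ N) ∧ ((V.sum ds₁ ≡ᵇ V.sum ds₂) ∧ (M ≡ᵇ N))))
            (sym (cong₂ _∧_ (trans (admissibleVec-spec o 0 nothing ns₁ ds₁)
                                   (cong (λ a → allPos ds₁ ∧ (a ∧ inOrder o nothing ns₁)) (atLeast-0 ns₁)))
                            (trans (admissibleVec-spec o 1 nothing ns₂ ds₂)
                                   (cong (λ a → allPos ds₂ ∧ (a ∧ inOrder o nothing ns₂)) (atLeast-1 ns₂))))))

  coefficient : ∀ o r s (u₁ t₁ : Vec ℕ r) (u₂ t₂ : Vec ℕ s) →
    fromℕℚ (boxSum (r ℕ.+ s) N (condition o r s N) (λ ns ds → monomial ns ds (u₁ ++ᵥ u₂) (t₁ ++ᵥ t₂)))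
      ≡ blockSum o (pairs u₁ t₁) (pairs u₂ t₂)
  coefficient o r s u₁ t₁ u₂ t₂ = begin
    fromℕℚ (boxSum (r ℕ.+ s) N (condition o r s N) (λ ns ds → monomial ns ds (u₁ ++ᵥ u₂) (t₁ ++ᵥ t₂)))
      ≡⟨ fromℕℚ-boxSum (r ℕ.+ s) N (condition o r s N) _ ⟩
    ∑ (tuples (r ℕ.+ s) N) (λ ns → ∑ (tuples (r ℕ.+ s) N) (G ns))
      ≡⟨ ∑-tuples² (r ℕ.+ s) G ⟩
    ∑∑ⁿ (r ℕ.+ s) G
      ≡⟨ ∑∑ⁿ-++ r s G ⟩
    ∑∑ⁿ r (λ ns₁ ds₁ → ∑∑ⁿ s (λ ns₂ ds₂ → G (ns₁ ++ᵥ ns₂) (ds₁ ++ᵥ ds₂)))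
      ≡⟨ ∑∑ⁿ-cong r (λ ns₁ ds₁ → trans (∑∑ⁿ-cong s (block-summand o u₁ t₁ ns₁ ds₁ u₂ t₂))
                                        (sym ([]·-*-∑∑ⁿ s (admissibleVec o 0 nothing ns₁ ds₁) (fromℕℚ (monomial ns₁ ds₁ u₁ t₁)) _))) ⟩
    ∑∑ⁿ r (λ ns₁ ds₁ → [ admissibleVec o 0 nothing ns₁ ds₁ ]· (fromℕℚ (monomial ns₁ ds₁ u₁ t₁) *
      ∑∑ⁿ s (λ ns₂ ds₂ → [ admissibleVec o 1 nothing ns₂ ds₂ ]· (fromℕℚ (monomial ns₂ ds₂ u₂ t₂) *
        balanced (V.sum ds₁) (V.sum ds₂) (dot ns₁ ds₁ ℕ.+ dot ns₂ ds₂)))))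
      ≡⟨ ∑∑ⁿ-cong r (λ ns₁ ds₁ → cong (λ z → [ admissibleVec o 0 nothing ns₁ ds₁ ]· (fromℕℚ (monomial ns₁ ds₁ u₁ t₁) * z))
                                       (chainSum-expansion o 1 u₂ t₂ (balanced (V.sum ds₁)) nothing 0 (dot ns₁ ds₁))) ⟨
    ∑∑ⁿ r (λ ns₁ ds₁ → [ admissibleVec o 0 nothing ns₁ ds₁ ]· (fromℕℚ (monomial ns₁ ds₁ u₁ t₁) *
      chainSum o 1 (pairs u₂ t₂) (balanced (V.sum ds₁)) nothing 0 (dot ns₁ ds₁)))
      ≡⟨ chainSum-expansion o 0 u₁ t₁ (λ DL M → chainSum o 1 (pairs u₂ t₂) (balanced DL) nothing 0 M) nothing 0 0 ⟨
    blockSum o (pairs u₁ t₁) (pairs u₂ t₂) ∎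
    where
    open ≡-Reasoning
    G : Vec ℕ (r ℕ.+ s) → Vec ℕ (r ℕ.+ s) → ℚ
    G ns ds = [ condition o r s N ns ds ]· fromℕℚ (monomial ns ds (u₁ ++ᵥ u₂) (t₁ ++ᵥ t₂))

uExponents tExponents : (c : Chain) → Vec ℕ (length c)
uExponents c = V.map proj₁ (V.fromList c)
tExponents c = V.map proj₂ (V.fromList c)

pairs-exponents : ∀ c → pairs (uExponents c) (tExponents c) ≡ c
pairs-exponents []      = refl
pairs-exponents (x ∷ c) = cong (x ∷_) (pairs-exponents c)

weight-++ : ∀ {r s} (u₁ t₁ : Vec ℕ r) (u₂ t₂ : Vec ℕ s) → weight (u₁ ++ᵥ u₂) (t₁ ++ᵥ t₂) ≡ weight u₁ t₁ ℕ.+ weight u₂ t₂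
weight-++ []       []       u₂ t₂ = refl
weight-++ (a ∷ u₁) (b ∷ t₁) u₂ t₂ = trans (cong (a ℕ.+ b ℕ.+ 1 ℕ.+_) (weight-++ u₁ t₁ u₂ t₂)) (sym (ℕ.+-assoc (a ℕ.+ b ℕ.+ 1) _ _))

chainWeight-pairs : ∀ {k} (u t : Vec ℕ k) → chainWeight (pairs u t) ≡ weight u t
chainWeight-pairs []      []      = refl
chainWeight-pairs (a ∷ u) (b ∷ t) = cong (a ℕ.+ b ℕ.+ 1 ℕ.+_) (chainWeight-pairs u t)

module _ {P : ℕ → Set} where

  All-pairs₁ : ∀ {k} (u t : Vec ℕ k) → VecAll.All P u → All (P ∘ proj₁) (pairs u t)
  All-pairs₁ []      []      []       = []
  All-pairs₁ (a ∷ u) (b ∷ t) (p ∷ ps) = p ∷ All-pairs₁ u t ps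

  All-pairs₂ : ∀ {k} (u t : Vec ℕ k) → VecAll.All P t → All (P ∘ proj₂) (pairs u t)
  All-pairs₂ []      []      []       = []
  All-pairs₂ (a ∷ u) (b ∷ t) (p ∷ ps) = p ∷ All-pairs₂ u t ps

  All-uExponents : ∀ c → All (P ∘ proj₁) c → VecAll.All P (uExponents c)
  All-uExponents []      []       = []
  All-uExponents (x ∷ c) (p ∷ ps) = p ∷ All-uExponents c ps

  All-tExponents : ∀ c → All (P ∘ proj₂) c → VecAll.All P (tExponents c)
  All-tExponents []      []       = []
  All-tExponents (x ∷ c) (p ∷ ps) = p ∷ All-tExponents c ps

blocksToTerm : ℚ × (Chain × Chain) → Term
blocksToTerm (q , cl , cr) = term q (length cl) (length cr) (uExponents cl ++ᵥ uExponents cr) (tExponents cl ++ᵥ tExponents cr)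

termCoeff : ℕ → Term → ℚ
termCoeff N (term c f g ũ t̃) = c * fromℕℚ (coeffT f g ũ t̃ N)

combCoeff≡∑ : ∀ L N → combCoeff L N ≡ ∑ L (termCoeff N)
combCoeff≡∑ []                       N = refl
combCoeff≡∑ (term c f g ũ t̃ ∷ L) N = cong (c * fromℕℚ (coeffT f g ũ t̃ N) +_) (combCoeff≡∑ L N)

weight-exponents : ∀ c → weight (uExponents c) (tExponents c) ≡ chainWeight c
weight-exponents c = trans (sym (chainWeight-pairs (uExponents c) (tExponents c))) (cong chainWeight (pairs-exponents c))

module _ {r s : ℕ} (u₁ t₁ : Vec ℕ r) (u₂ t₂ : Vec ℕ s) where

  terms : List Term
  terms = map blocksToTerm (orderings (pairs u₁ t₁) ⊗ₗ orderings (pairs u₂ t₂))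

  terms-coefficients : ∀ N → fromℕℚ (coeffS r s (u₁ ++ᵥ u₂) (t₁ ++ᵥ t₂) N) ≡ combCoeff terms N
  terms-coefficients N = begin
    fromℕℚ (coeffS r s (u₁ ++ᵥ u₂) (t₁ ++ᵥ t₂) N)
      ≡⟨ Coefficients.coefficient N false r s u₁ t₁ u₂ t₂ ⟩
    blockSum false (pairs u₁ t₁) (pairs u₂ t₂)
      ≡⟨ blockSum-symmetrization (pairs u₁ t₁) (pairs u₂ t₂) ⟩
    combine Os (λ p → blockSum true (proj₁ p) (proj₂ p))
      ≡⟨ combine-cong Os (λ p → sym (trans (Coefficients.coefficient N true _ _ (uExponents (proj₁ p)) (tExponents (proj₁ p))
                                                                                (uExponents (proj₂ p)) (tExponents (proj₂ p)))
                                            (cong₂ (blockSum true) (pairs-exponents (proj₁ p)) (pairs-exponents (proj₂ p))))) ⟩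
    ∑ Os (termCoeff N ∘ blocksToTerm)
      ≡⟨ ∑-map blocksToTerm Os (termCoeff N) ⟨
    ∑ terms (termCoeff N)
      ≡⟨ combCoeff≡∑ terms N ⟨
    combCoeff terms N ∎
    where
    open ≡-Reasoning
    open ChainSums N
    Os = orderings (pairs u₁ t₁) ⊗ₗ orderings (pairs u₂ t₂)

  blocksToTerm-admissible : ∀ {cl cr} q → 1 ≤ r → 1 ≤ s → cl ≼ pairs u₁ t₁ → cr ≼ pairs u₂ t₂ →
    Admissible (u₁ ++ᵥ u₂) (t₁ ++ᵥ t₂) (blocksToTerm (q , cl , cr))
  blocksToTerm-admissible {cl} {cr} q 1≤r 1≤s cl≼ cr≼ =
    nonempty cl≼ (subst (1 ≤_) (sym (length-toList (V.zip u₁ t₁))) 1≤r) ,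
    nonempty cr≼ (subst (1 ≤_) (sym (length-toList (V.zip u₂ t₂))) 1≤s) ,
    weight≤ ,
    (λ pos → let pos₁ , pos₂ = VecAllₚ.++⁻ t₁ pos in
             VecAllₚ.++⁺ (All-tExponents cl (t-pos cl≼ (All-pairs₂ u₁ t₁ pos₁))) (All-tExponents cr (t-pos cr≼ (All-pairs₂ u₂ t₂ pos₂)))) ,
    (λ pos → let pos₁ , pos₂ = VecAllₚ.++⁻ u₁ pos in
             VecAllₚ.++⁺ (All-uExponents cl (u-pos cl≼ (All-pairs₁ u₁ t₁ pos₁))) (All-uExponents cr (u-pos cr≼ (All-pairs₁ u₂ t₂ pos₂))))
    where
    open ℕ.≤-Reasoning
    weight≤ : weight (uExponents cl ++ᵥ uExponents cr) (tExponents cl ++ᵥ tExponents cr) ≤ weight (u₁ ++ᵥ u₂) (t₁ ++ᵥ t₂)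
    weight≤ = begin
      weight (uExponents cl ++ᵥ uExponents cr) (tExponents cl ++ᵥ tExponents cr)
        ≡⟨ weight-++ (uExponents cl) (tExponents cl) (uExponents cr) (tExponents cr) ⟩
      weight (uExponents cl) (tExponents cl) ℕ.+ weight (uExponents cr) (tExponents cr)
        ≡⟨ cong₂ ℕ._+_ (weight-exponents cl) (weight-exponents cr) ⟩
      chainWeight cl ℕ.+ chainWeight cr
        ≤⟨ ℕ.+-mono-≤ (weight-≤ cl≼) (weight-≤ cr≼) ⟩
      chainWeight (pairs u₁ t₁) ℕ.+ chainWeight (pairs u₂ t₂)
        ≡⟨ cong₂ ℕ._+_ (chainWeight-pairs u₁ t₁) (chainWeight-pairs u₂ t₂) ⟩
      weight u₁ t₁ ℕ.+ weight u₂ t₂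
        ≡⟨ weight-++ u₁ t₁ u₂ t₂ ⟨
      weight (u₁ ++ᵥ u₂) (t₁ ++ᵥ t₂) ∎

  terms-admissible : 1 ≤ r → 1 ≤ s → All (Admissible (u₁ ++ᵥ u₂) (t₁ ++ᵥ t₂)) terms
  terms-admissible 1≤r 1≤s = map⁺ (All.map (λ { {q , cl , cr} (cl≼ , cr≼) → blocksToTerm-admissible q 1≤r 1≤s cl≼ cr≼ })
                                                (All-⊗ₗ (orderings-≼ (pairs u₁ t₁)) (orderings-≼ (pairs u₂ t₂))))

Expansion : (r s : ℕ) → Vec ℕ (r ℕ.+ s) → Vec ℕ (r ℕ.+ s) → Set
Expansion r s u t = Σ (List Term) (λ L → All (Admissible u t) L × ((N : ℕ) → fromℕℚ (coeffS r s u t N) ≡ combCoeff L N))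

blocks-expansion : ∀ {r s} (u₁ t₁ : Vec ℕ r) (u₂ t₂ : Vec ℕ s) → 1 ≤ r → 1 ≤ s → Expansion r s (u₁ ++ᵥ u₂) (t₁ ++ᵥ t₂)
blocks-expansion u₁ t₁ u₂ t₂ 1≤r 1≤s = terms u₁ t₁ u₂ t₂ , terms-admissible u₁ t₁ u₂ t₂ 1≤r 1≤s , terms-coefficients u₁ t₁ u₂ t₂

lemma4p2 : (r s : ℕ) → 1 ≤ r → 1 ≤ s → (u t : Vec ℕ (r ℕ.+ s)) →
    Σ (List Term) (λ L → All (Admissible u t) L
    × ((N : ℕ) → fromℕℚ (coeffS r s u t N) ≡ combCoeff L N))
lemma4p2 r s 1≤r 1≤s u t = subst₂ (Expansion r s) (take++drop≡id r u) (take++drop≡id r t)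
  (blocks-expansion (take r u) (take r t) (drop r u) (drop r t) 1≤r 1≤s)
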